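{- Let $\Omega$ be the set of $13$ points of the projective plane $\mathrm{PG}_2(3)$, let $\varGamma=O_7=K(13,6)$ with underlying set $\Omega$, and let $C$ be the set of all vertices of the form $\ell_1\triangle\ell_2$ (symmetric difference of point sets) where $\ell_1,\ell_2$ range over distinct pairs of lines of $\mathrm{PG}_2(3)$. Then $C$ is neighbour-transitive, $|C|=78$, $C$ has minimum distance $\delta=1$, and $\mathrm{Aut}(C)=\mathrm{P\Gamma L}_3(3)$.
   Context: The odd graph $O_7=K(13,6)$ has as vertices the $6$-subsets of the $13$-set $\Omega$, adjacent iff disjoint; its automorphism group is $\mathrm{Sym}(\Omega)$. For a code $C$ (set of vertices), with $d$ graph distance, the minimum distance $\delta$ is the least distance between distinct codewords; $C_1$ is the set of vertices not in $C$ but adjacent to some codeword; $\mathrm{Aut}(C)$ is the setwise stabiliser of $C$ in $\mathrm{Sym}(\Omega)$; $C$ is neighbour-transitive if $C_1\neq\emptyset$ and $\mathrm{Aut}(C)$ is transitive on $C$ and on $C_1$. -}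

module Defs where

open import Data.Nat using (ℕ; zero; suc; _+_; _*_; _%_; _≤_)
open import Data.Nat.Properties using (_≟_)
open import Data.Bool using (Bool; true; false; _xor_; if_then_else_)
open import Data.Fin using (Fin; zero; suc)
open import Data.Fin.Subset using (Subset; _∩_; ⊥; ∣_∣; inside; outside)
open import Data.Fin.Permutation using (Permutation′; _⟨$⟩ʳ_; _⟨$⟩ˡ_)
open import Data.Vec using (Vec; []; _∷_; lookup; tabulate; zipWith)
open import Data.List using (List; length)
open import Data.List.Membership.Propositional using (_∈_)
open import Data.List.Relation.Unary.Unique.Propositional using (Unique)
open import Data.Product using (Σ; ∃; _×_; _,_)
open import Relation.Binary.PropositionalEquality using (_≡_; _≢_)
open import Relation.Nullary using (¬_; does)
open import Function.Bundles using (_⇔_)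

-- The field F₃ is represented by natural numbers modulo 3.

_≡₃_ : ℕ → ℕ → Set
a ≡₃ b = a % 3 ≡ b % 3

-- Vectors of F₃³ (entries read mod 3)
V3 : Set
V3 = Fin 3 → ℕ

v3 : ℕ → ℕ → ℕ → V3
v3 a b c zero = a
v3 a b c (suc zero) = b
v3 a b c (suc (suc zero)) = c

dot : V3 → V3 → ℕ
dot u v = u zero * v zero + u (suc zero) * v (suc zero)
        + u (suc (suc zero)) * v (suc (suc zero))

-- PG₂(3): the 13 points are the 1-dimensional subspaces of F₃³,
-- listed by their normalised representatives (first nonzero coord = 1).
-- Ω = Fin 13 is this set of points.

reps : Vec V3 13
reps = v3 0 0 1 ∷ v3 0 1 0 ∷ v3 0 1 1 ∷ v3 0 1 2 ∷ v3 1 0 0 ∷ v3 1 0 1 ∷ v3 1 0 2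
     ∷ v3 1 1 0 ∷ v3 1 1 1 ∷ v3 1 1 2 ∷ v3 1 2 0 ∷ v3 1 2 1 ∷ v3 1 2 2 ∷ []

Ω : Set
Ω = Fin 13

pt : Ω → V3
pt p = lookup reps p

-- The 13 lines are the 2-dimensional subspaces of F₃³, i.e. the kernels of
-- the nonzero linear forms up to scalars; line L consists of the points p
-- with  pt L · pt p = 0  in F₃.
Line : Set
Line = Fin 13

line : Line → Subset 13
line L = tabulate (λ p → if does (dot (pt L) (pt p) % 3 ≟ 0) then inside else outside)

Vertex : Subset 13 → Set
Vertex s = ∣ s ∣ ≡ 6

Adj : Subset 13 → Subset 13 → Set
Adj x y = Vertex x × Vertex y × (x ∩ y ≡ ⊥)

data Walk : Subset 13 → Subset 13 → ℕ → Set where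
  nil  : ∀ {x} → Vertex x → Walk x x 0
  step : ∀ {x y z k} → Adj x y → Walk y z k → Walk x z (suc k)

Dist : Subset 13 → Subset 13 → ℕ → Set
Dist x y k = Walk x y k × (∀ m → Walk x y m → k ≤ m)

Code : Set₁
Code = Subset 13 → Set

MinDist : Code → ℕ → Set
MinDist C δ =
  (Σ (Subset 13) λ c → Σ (Subset 13) λ c' → C c × C c' × c ≢ c' × Dist c c' δ)
  × (∀ c c' → C c → C c' → c ≢ c' → ∀ m → Walk c c' m → δ ≤ m)

C₁ : Code → Code
C₁ C s = Vertex s × ¬ C s × (Σ (Subset 13) λ c → C c × Adj s c)

HasSize : Code → ℕ → Set
HasSize C n = Σ (List (Subset 13)) λ xs → Unique xs × length xs ≡ n × (∀ s → C s ⇔ s ∈ xs)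

image : Permutation′ 13 → Subset 13 → Subset 13
image σ s = tabulate (λ i → lookup s (σ ⟨$⟩ˡ i))

InAut : Code → Permutation′ 13 → Set
InAut C σ = ∀ s → C s ⇔ C (image σ s)

NeighbourTransitive : Code → Set
NeighbourTransitive C =
  (Σ (Subset 13) λ s → C₁ C s)
  × (∀ c c' → C c → C c' → Σ (Permutation′ 13) λ σ → InAut C σ × image σ c ≡ c')
  × (∀ x x' → C₁ C x → C₁ C x' → Σ (Permutation′ 13) λ σ → InAut C σ × image σ x ≡ x')

-- PΓL₃(3) acting on Ω.  Since F₃ has only the trivial field automorphism,
-- ΓL₃(3) = GL₃(3); an element of PΓL₃(3) is the permutation of points
-- induced by an invertible 3×3 matrix over F₃.

Mat : Set
Mat = Fin 3 → Fin 3 → ℕ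

_·_ : Mat → V3 → V3
(A · v) i = dot (A i) v

-- det A = detPos A - detNeg A
detPos : Mat → ℕ
detPos A = A zero zero * A (suc zero) (suc zero) * A (suc (suc zero)) (suc (suc zero))
         + A zero (suc zero) * A (suc zero) (suc (suc zero)) * A (suc (suc zero)) zero
         + A zero (suc (suc zero)) * A (suc zero) zero * A (suc (suc zero)) (suc zero)

detNeg : Mat → ℕ
detNeg A = A zero (suc (suc zero)) * A (suc zero) (suc zero) * A (suc (suc zero)) zero
         + A zero zero * A (suc zero) (suc (suc zero)) * A (suc (suc zero)) (suc zero)
         + A zero (suc zero) * A (suc zero) zero * A (suc (suc zero)) (suc (suc zero))

Invertible₃ : Mat → Set
Invertible₃ A = ¬ (detPos A ≡₃ detNeg A)

SamePoint : V3 → V3 → Set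
SamePoint u v = Σ ℕ λ c → ¬ (c ≡₃ 0) × (∀ i → u i ≡₃ (c * v i))

InPΓL₃3 : Permutation′ 13 → Set
InPΓL₃3 σ = Σ Mat λ A → Invertible₃ A × (∀ p → SamePoint (A · pt p) (pt (σ ⟨$⟩ʳ p)))

_△_ : Subset 13 → Subset 13 → Subset 13
s △ t = zipWith _xor_ s t

LineCode : Code
LineCode s = Σ Line λ L₁ → Σ Line λ L₂ → L₁ ≢ L₂ × s ≡ line L₁ △ line L₂

-- PΓL₃(3) maps lines to lines and hence preserves C. Conversely, three distinct
-- points lie in exactly three codewords if they are collinear and in six
-- otherwise; an automorphism of C permutes the codewords through a triple, so it
-- preserves collinearity and is a collineation. A collineation is determined by
-- the image of the frame e₁, e₂, e₃, e₁+e₂+e₃, since every point is an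
-- intersection of joins of earlier ones, and a stabiliser chain of matrices moves
-- this frame onto any frame, so every collineation lies in PΓL₃(3). The same
-- transitivity on frames moves ℓ₀ △ ℓ₁ onto any codeword ℓ₁ △ ℓ₂; a vertex adjacent
-- to ℓ₁ △ ℓ₂ is its complement minus a point q, where q ∉ ℓ₁ ∩ ℓ₂ (otherwise the
-- vertex is itself a codeword), so a frame through ℓ₁ ∩ ℓ₂ and q moves a fixed
-- neighbour of ℓ₀ △ ℓ₁ onto it. Finite facts about the plane are decided by evaluation.
module Submission where

open import Defs
open import Data.Product using (_×_)
open import Data.Fin.Permutation using (Permutation′)
open import Function.Bundles using (_⇔_)

open import Level using (0ℓ)
open import Data.Bool using (Bool; not; _xor_; if_then_else_)
open import Data.Bool.Properties using (xor-comm) renaming (_≟_ to _≟ᵇ_)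
open import Data.Empty using (⊥-elim)
open import Data.Nat as ℕ using (ℕ; zero; suc; _+_; _*_; _%_; _∸_; _≤_; s≤s; z≤n)
open import Data.Nat.DivMod using (_mod_; %-distribˡ-+; %-distribˡ-*; m%n%n≡m%n; m%n<n)
open import Data.Nat.Properties using (1+n≰n; ≤-pred; ≤-trans; *-assoc; *-zeroʳ; _≤?_)
  renaming (_≟_ to _≟ⁿ_)
open import Data.Nat.Tactic.RingSolver using (solve-∀)
open import Data.Fin as Fin using (Fin; zero; suc; toℕ; #_; punchOut)
open import Data.Fin.Properties
  using (all?; any?; _<?_; <-cmp; <⇒≢; injective⇒≤; punchOut-injective; toℕ-fromℕ<)
  renaming (_≟_ to _≟ᶠ_)
open import Data.Fin.Permutation using (permutation; _⟨$⟩ʳ_; _⟨$⟩ˡ_; inverseˡ; inverseʳ; flip; _∘ₚ_)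
open import Data.Fin.Subset
  using (Subset; _∈_; _∉_; _⊆_; _∩_; _-_; _─_; ∁; ⁅_⁆; ⊥; ∣_∣; inside; outside)
open import Data.Fin.Subset.Properties
  using (_∈?_; ⊆-antisym; p⊆q⇒∣p∣≤∣q∣; p⊂q⇒∣p∣<∣q∣; x∈p⇒∣p-x∣<∣p∣; x∈p∧x≢y⇒x∈p-y; x∈⁅x⁆; x∈⁅y⁆⇒x≡y;
         ∉⊥; x∈p∩q⁺; x∉p⇒x∈∁p; x∈∁p⇒x∉p; ∣∁p∣≡n∸∣p∣)
open import Data.Vec as Vec using (Vec; []; _∷_; lookup; tabulate; zipWith)
open import Data.Vec.Properties
  using ([]=⇒lookup; lookup⇒[]=; lookup∘tabulate; tabulate∘lookup; tabulate-cong; lookup-zipWith; lookup-map;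
         zipWith-comm)
  renaming (≡-dec to ≡-decᵛ)
open import Data.List as List using (List; []; _∷_; length; filter; allFin; cartesianProduct)
open import Data.List.Properties using (filter-≐)
open import Data.List.Membership.Propositional using () renaming (_∈_ to _∈ₗ_)
open import Data.List.Membership.Propositional.Properties
  using (∈-lookup; ∈-filter⁺; ∈-filter⁻; ∈-allFin; ∈-map⁺; ∈-map⁻; ∈-cartesianProduct⁺)
open import Data.List.Membership.DecPropositional (≡-decᵛ {n = 13} _≟ᵇ_) using () renaming (_∈?_ to _∈ₗ?_)
open import Data.List.Relation.Unary.Any using (here; there; index)
open import Data.List.Relation.Unary.Any.Properties using (lookup-index)
open import Data.List.Relation.Unary.All as All using ([]; _∷_)
open import Data.List.Relation.Unary.AllPairs using (_∷_)
open import Data.List.Relation.Unary.Unique.Propositional using (Unique)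
open import Data.List.Relation.Unary.Unique.Propositional.Properties using (allFin⁺)
  renaming (filter⁺ to Unique-filter⁺)
open import Data.List.Relation.Unary.Unique.DecPropositional (≡-decᵛ {n = 13} _≟ᵇ_) using (unique?)
open import Data.Product using (Σ; ∃-syntax; _,_; proj₁; proj₂; uncurry)
open import Data.Sum using (_⊎_; inj₁; inj₂)
open import Function using (_∘_)
open import Function.Bundles using (mk⇔; Equivalence)
open import Function.Construct.Composition using (_⇔-∘_)
open import Function.Construct.Symmetry using (⇔-sym)
open import Function.Definitions using (Injective)
open import Relation.Binary using (IsEquivalence; Setoid) renaming (Decidable to Decidable₂)
open import Relation.Binary.Definitions using (Tri; tri<; tri≈; tri>)
open import Relation.Binary.PropositionalEquality
  using (_≡_; _≢_; refl; sym; trans; cong; cong₂; subst; subst₂; module ≡-Reasoning)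
import Relation.Binary.Reasoning.Setoid as SetoidReasoning
open import Relation.Nullary using (¬_; Dec; yes; no; does)
open import Relation.Nullary.Decidable
  using (True; toWitness; map′; decidable-stable; _×-dec_; _→-dec_; _⊎-dec_; ¬?)
open import Relation.Unary using (Pred; Decidable)

open Equivalence using (to; from)

-- Finite combinatorics

decide : ∀ {A : Set} (A? : Dec A) {_ : True A?} → A
decide A? {a} = toWitness a

-- junk value when P holds nowhere: the last element
first : ∀ {n} {P : Pred (Fin (suc n)) 0ℓ} → Decidable P → Fin (suc n)
first {zero}  P? = zero
first {suc n} P? = if does (P? zero) then zero else suc (first (P? ∘ suc))

injective⇒surjective : ∀ {n} {f : Fin n → Fin n} → Injective _≡_ _≡_ f → ∀ y → ∃[ x ] f x ≡ y
injective⇒surjective {suc n} {f} f-inj y with any? (λ x → f x ≟ᶠ y)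
... | yes found  = found
... | no missing = ⊥-elim (1+n≰n (injective⇒≤ squeezed-injective))
  where
  avoids : ∀ x → y ≢ f x
  avoids x y≡fx = missing (x , sym y≡fx)

  squeezed : Fin (suc n) → Fin n
  squeezed x = punchOut (avoids x)

  squeezed-injective : Injective _≡_ _≡_ squeezed
  squeezed-injective eq = f-inj (punchOut-injective (avoids _) (avoids _) eq)

module _ {A : Set} where

  lookup-injective : ∀ {xs : List A} → Unique xs → Injective _≡_ _≡_ (List.lookup xs)
  lookup-injective (_    ∷ _)  {zero}  {zero}  _  = refl
  lookup-injective (x∉xs ∷ _)  {zero}  {suc j} eq = ⊥-elim (All.lookup x∉xs (∈-lookup j) eq)
  lookup-injective (x∉xs ∷ _)  {suc i} {zero}  eq = ⊥-elim (All.lookup x∉xs (∈-lookup i) (sym eq))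
  lookup-injective (_    ∷ xs!) {suc i} {suc j} eq = cong suc (lookup-injective xs! eq)

  length-≤-injection : ∀ {B : Set} {xs : List A} {ys : List B} (f : A → B) →
    Unique xs → Injective _≡_ _≡_ f → (∀ {x} → x ∈ₗ xs → f x ∈ₗ ys) → length xs ≤ length ys
  length-≤-injection {xs = xs} {ys} f xs! f-inj into = injective⇒≤ position-injective
    where
    position : Fin (length xs) → Fin (length ys)
    position i = index (into (∈-lookup i))

    position-injective : Injective _≡_ _≡_ position
    position-injective {i} {j} eq = lookup-injective xs! (f-inj (
      trans (lookup-index (into (∈-lookup i)))
            (trans (cong (List.lookup ys) eq) (sym (lookup-index (into (∈-lookup j)))))))

module _ {n : ℕ} where

  private
    missing-or-⊆ : ∀ (p q : Subset n) → (∃[ y ] y ∈ q × y ∉ p) ⊎ q ⊆ p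
    missing-or-⊆ p q with any? (λ y → y ∈? q ×-dec ¬? (y ∈? p))
    ... | yes (y , y∈q , y∉p) = inj₁ (y , y∈q , y∉p)
    ... | no none = inj₂ λ {y} y∈q → decidable-stable (y ∈? p) (λ y∉p → none (y , y∈q , y∉p))

  ⊆∧∣∣≤⇒≡ : ∀ {p q : Subset n} → p ⊆ q → ∣ q ∣ ≤ ∣ p ∣ → p ≡ q
  ⊆∧∣∣≤⇒≡ {p} {q} p⊆q ∣q∣≤∣p∣ with missing-or-⊆ p q
  ... | inj₁ witness = ⊥-elim (1+n≰n (≤-trans (p⊂q⇒∣p∣<∣q∣ (p⊆q , witness)) ∣q∣≤∣p∣))
  ... | inj₂ q⊆p = ⊆-antisym p⊆q q⊆p

  ⊆∧∣∣≡suc⇒≡- : ∀ {p q : Subset n} → p ⊆ q → ∣ q ∣ ≡ suc ∣ p ∣ → ∃[ y ] y ∈ q × p ≡ q - y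
  ⊆∧∣∣≡suc⇒≡- {p} {q} p⊆q ∣q∣≡1+∣p∣ with missing-or-⊆ p q
  ... | inj₂ q⊆p = ⊥-elim (1+n≰n (subst (_≤ ∣ p ∣) ∣q∣≡1+∣p∣ (p⊆q⇒∣p∣≤∣q∣ q⊆p)))
  ... | inj₁ (y , y∈q , y∉p) = y , y∈q , ⊆∧∣∣≤⇒≡ p⊆q-y ∣q-y∣≤∣p∣
    where
    p⊆q-y : p ⊆ q - y
    p⊆q-y x∈p = x∈p∧x≢y⇒x∈p-y (p⊆q x∈p) λ { refl → y∉p x∈p }

    ∣q-y∣≤∣p∣ : ∣ q - y ∣ ≤ ∣ p ∣
    ∣q-y∣≤∣p∣ = ≤-pred (subst (∣ q - y ∣ ℕ.<_) ∣q∣≡1+∣p∣ (x∈p⇒∣p-x∣<∣p∣ y∈q))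


-- Arithmetic modulo 3

_≡₃?_ : Decidable₂ _≡₃_
a ≡₃? b = a % 3 ≟ⁿ b % 3

-- a ≡₃ b unfolds to an equation between remainders, which hides a and b
-- from the unifier; the wrapper keeps them visible.
infix 4 _≈₃_
record _≈₃_ (a b : ℕ) : Set where
  constructor mod₃
  field unmod₃ : a ≡₃ b
open _≈₃_ public

≈₃-refl : ∀ {a} → a ≈₃ a
≈₃-refl = mod₃ refl

≈₃-sym : ∀ {a b} → a ≈₃ b → b ≈₃ a
≈₃-sym (mod₃ a≡b) = mod₃ (sym a≡b)

≈₃-trans : ∀ {a b c} → a ≈₃ b → b ≈₃ c → a ≈₃ c
≈₃-trans (mod₃ a≡b) (mod₃ b≡c) = mod₃ (trans a≡b b≡c)

≈₃-isEquivalence : IsEquivalence _≈₃_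
≈₃-isEquivalence = record { refl = ≈₃-refl ; sym = ≈₃-sym ; trans = ≈₃-trans }

≈₃-setoid : Setoid 0ℓ 0ℓ
≈₃-setoid = record { isEquivalence = ≈₃-isEquivalence }

≡⇒≈₃ : ∀ {a b} → a ≡ b → a ≈₃ b
≡⇒≈₃ refl = mod₃ refl

+-cong₃ : ∀ {a b c d} → a ≈₃ b → c ≈₃ d → a + c ≈₃ b + d
+-cong₃ {a} {b} {c} {d} (mod₃ a≡b) (mod₃ c≡d) = mod₃ (begin
  (a + c) % 3         ≡⟨ %-distribˡ-+ a c 3 ⟩
  (a % 3 + c % 3) % 3 ≡⟨ cong₂ (λ x y → (x + y) % 3) a≡b c≡d ⟩
  (b % 3 + d % 3) % 3 ≡⟨ %-distribˡ-+ b d 3 ⟨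
  (b + d) % 3         ∎)
  where open ≡-Reasoning

*-cong₃ : ∀ {a b c d} → a ≈₃ b → c ≈₃ d → a * c ≈₃ b * d
*-cong₃ {a} {b} {c} {d} (mod₃ a≡b) (mod₃ c≡d) = mod₃ (begin
  (a * c) % 3           ≡⟨ %-distribˡ-* a c 3 ⟩
  (a % 3 * (c % 3)) % 3 ≡⟨ cong₂ (λ x y → (x * y) % 3) a≡b c≡d ⟩
  (b % 3 * (d % 3)) % 3 ≡⟨ %-distribˡ-* b d 3 ⟨
  (b * d) % 3           ∎)
  where open ≡-Reasoning

residue : ℕ → Fin 3
residue n = n mod 3

toℕ-residue : ∀ n → toℕ (residue n) ≈₃ n
toℕ-residue n = mod₃ (trans (cong (_% 3) (toℕ-fromℕ< (m%n<n n 3))) (m%n%n≡m%n n 3))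

abstract
  F₃-no-zero-divisors : ∀ (r s : Fin 3) → ¬ toℕ r ≡₃ 0 → (toℕ r * toℕ s) ≡₃ 0 → toℕ s ≡₃ 0
  F₃-no-zero-divisors = decide (all? λ r → all? λ s →
    ¬? (toℕ r ≡₃? 0) →-dec ((toℕ r * toℕ s) ≡₃? 0) →-dec (toℕ s ≡₃? 0))

*-cancelˡ₃ : ∀ {c x} → ¬ c ≈₃ 0 → c * x ≈₃ 0 → x ≈₃ 0
*-cancelˡ₃ {c} {x} c≢0 cx≡0 = begin
  x                   ≈⟨ toℕ-residue x ⟨
  toℕ (residue x)     ≈⟨ mod₃ (F₃-no-zero-divisors (residue c) (residue x) (c≢0 ∘ r≈c) rs≈0) ⟩
  0                   ∎
  where
  open SetoidReasoning ≈₃-setoid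
  r≈c : toℕ (residue c) ≡₃ 0 → c ≈₃ 0
  r≈c r≡0 = ≈₃-trans (≈₃-sym (toℕ-residue c)) (mod₃ r≡0)
  rs≈0 : (toℕ (residue c) * toℕ (residue x)) ≡₃ 0
  rs≈0 = unmod₃ (≈₃-trans (*-cong₃ (toℕ-residue c) (toℕ-residue x)) cx≡0)

private
  ⟦_⟧ : ℕ → ℕ
  ⟦ n ⟧ = toℕ (residue n)

abstract
  F₃-+-cancelˡ : ∀ (r s t : Fin 3) → (toℕ r + toℕ s) ≡₃ (toℕ r + toℕ t) → toℕ s ≡₃ toℕ t
  F₃-+-cancelˡ = decide (all? λ r → all? λ s → all? λ t →
    ((toℕ r + toℕ s) ≡₃? (toℕ r + toℕ t)) →-dec (toℕ s ≡₃? toℕ t))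

  -- (p − n)(p′ − n′) ≠ 0 in F₃ when p ≠ n and p′ ≠ n′
  F₃-difference-product : ∀ (p n p′ n′ : Fin 3) → ¬ toℕ p ≡₃ toℕ n → ¬ toℕ p′ ≡₃ toℕ n′ →
    ¬ (toℕ p * toℕ n′ + toℕ n * toℕ p′) ≡₃ (toℕ p * toℕ p′ + toℕ n * toℕ n′)
  F₃-difference-product = decide (all? λ p → all? λ n → all? λ p′ → all? λ n′ →
    ¬? (toℕ p ≡₃? toℕ n) →-dec ¬? (toℕ p′ ≡₃? toℕ n′) →-dec
    ¬? ((toℕ p * toℕ n′ + toℕ n * toℕ p′) ≡₃? (toℕ p * toℕ p′ + toℕ n * toℕ n′)))

+-cancelˡ₃ : ∀ {a b x y} → a ≈₃ b → a + x ≈₃ b + y → x ≈₃ y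
+-cancelˡ₃ {a} {b} {x} {y} a≈b ax≈by = begin
  x      ≈⟨ toℕ-residue x ⟨
  ⟦ x ⟧  ≈⟨ mod₃ (F₃-+-cancelˡ (residue b) (residue x) (residue y) (unmod₃ bx≈by)) ⟩
  ⟦ y ⟧  ≈⟨ toℕ-residue y ⟩
  y      ∎
  where
  open SetoidReasoning ≈₃-setoid
  bx≈by : ⟦ b ⟧ + ⟦ x ⟧ ≈₃ ⟦ b ⟧ + ⟦ y ⟧
  bx≈by = begin
    ⟦ b ⟧ + ⟦ x ⟧ ≈⟨ +-cong₃ (≈₃-trans (toℕ-residue b) (≈₃-sym a≈b)) (toℕ-residue x) ⟩
    a + x         ≈⟨ ax≈by ⟩
    b + y         ≈⟨ +-cong₃ (toℕ-residue b) (toℕ-residue y) ⟨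
    ⟦ b ⟧ + ⟦ y ⟧ ∎

*-nonzero₃ : ∀ {a b} → ¬ a ≈₃ 0 → ¬ b ≈₃ 0 → ¬ a * b ≈₃ 0
*-nonzero₃ a≢0 b≢0 ab≡0 = b≢0 (*-cancelˡ₃ a≢0 ab≡0)

-- The projective plane PG₂(3)

∈-tabulate⇔ : ∀ {n} (f : Fin n → Bool) {i} → i ∈ tabulate f ⇔ f i ≡ inside
∈-tabulate⇔ f {i} = mk⇔
  (λ i∈ → trans (sym (lookup∘tabulate f i)) ([]=⇒lookup i∈))
  (λ fi → lookup⇒[]= i (tabulate f) (trans (lookup∘tabulate f i) fi))

if-does⇔ : ∀ {A : Set} (A? : Dec A) → (if does A? then inside else outside) ≡ inside ⇔ A
if-does⇔ (yes a)  = mk⇔ (λ _ → a) (λ _ → refl)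
if-does⇔ (no ¬a) = mk⇔ (λ ()) (⊥-elim ∘ ¬a)

∈-line⇔ : ∀ L p → p ∈ line L ⇔ dot (pt L) (pt p) ≈₃ 0
∈-line⇔ L p = mk⇔ mod₃ unmod₃ ⇔-∘ (if-does⇔ (dot (pt L) (pt p) % 3 ≟ⁿ 0) ⇔-∘
  ∈-tabulate⇔ (λ q → if does (dot (pt L) (pt q) % 3 ≟ⁿ 0) then inside else outside))

Collinear : Ω → Ω → Ω → Set
Collinear x y z = ∃[ L ] x ∈ line L × y ∈ line L × z ∈ line L

collinear? : ∀ x y z → Dec (Collinear x y z)
collinear? x y z = any? λ L → x ∈? line L ×-dec y ∈? line L ×-dec z ∈? line L

record Frame (a b c d : Ω) : Set where
  constructor frame
  field
    ¬abc : ¬ Collinear a b c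
    ¬abd : ¬ Collinear a b d
    ¬acd : ¬ Collinear a c d
    ¬bcd : ¬ Collinear b c d

frame? : ∀ a b c d → Dec (Frame a b c d)
frame? a b c d = map′ (λ (abc , abd , acd , bcd) → frame abc abd acd bcd)
                      (λ (frame abc abd acd bcd) → abc , abd , acd , bcd)
  (¬? (collinear? a b c) ×-dec ¬? (collinear? a b d) ×-dec ¬? (collinear? a c d) ×-dec ¬? (collinear? b c d))

join : Ω → Ω → Line
join x y = first λ L → x ∈? line L ×-dec y ∈? line L

abstract
  ∈-join : ∀ x y → x ∈ line (join x y) × y ∈ line (join x y)
  ∈-join = decide (all? λ x → all? λ y → x ∈? line (join x y) ×-dec y ∈? line (join x y))

abstract
  join-unique : ∀ {x y L} → x ≢ y → x ∈ line L → y ∈ line L → L ≡ join x y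
  join-unique {x} {y} {L} = decide (all? λ x → all? λ y → all? λ L →
    ¬? (x ≟ᶠ y) →-dec x ∈? line L →-dec y ∈? line L →-dec L ≟ᶠ join x y) x y L

firstPoint secondPoint : Line → Ω
firstPoint L = first (_∈? line L)
secondPoint L = first λ p → p ∈? line L ×-dec ¬? (p ≟ᶠ firstPoint L)

abstract
  two-points-on : ∀ L → firstPoint L ≢ secondPoint L × firstPoint L ∈ line L × secondPoint L ∈ line L
  two-points-on = decide (all? λ L →
    ¬? (firstPoint L ≟ᶠ secondPoint L) ×-dec firstPoint L ∈? line L ×-dec secondPoint L ∈? line L)

  spanned-by-two-points : ∀ {L p} → p ∈ line L →
    ∃[ α ] ∃[ β ] ∀ k → pt p k ≡₃ (toℕ {3} α * pt (firstPoint L) k + toℕ {3} β * pt (secondPoint L) k)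
  spanned-by-two-points {L} {p} = decide (all? λ L → all? λ p → p ∈? line L →-dec
    (any? λ α → any? λ β → all? λ k →
      pt p k ≡₃? (toℕ α * pt (firstPoint L) k + toℕ β * pt (secondPoint L) k))) L p

noncollinear⇒≢ : ∀ {a b c} → ¬ Collinear a b c → a ≢ b
noncollinear⇒≢ {a} {b} {c} ¬abc refl =
  ¬abc (join a c , proj₁ (∈-join a c) , proj₁ (∈-join a c) , proj₂ (∈-join a c))

two-lines-meet-once : ∀ {L M p q} → L ≢ M → p ∈ line L → q ∈ line L → p ∈ line M → q ∈ line M → p ≡ q
two-lines-meet-once {L} {M} {p} {q} L≢M p∈L q∈L p∈M q∈M with p ≟ᶠ q
... | yes p≡q = p≡q
... | no p≢q  =
  ⊥-elim (L≢M (trans (join-unique {p} {q} {L} p≢q p∈L q∈L) (sym (join-unique {p} {q} {M} p≢q p∈M q∈M))))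

pointsOn : Line → List Ω
pointsOn L = filter (_∈? line L) (allFin 13)

abstract
  length-pointsOn : ∀ L → length (pointsOn L) ≡ 4
  length-pointsOn = decide (all? λ L → length (pointsOn L) ≟ⁿ 4)

abstract
  line-injective : Injective _≡_ _≡_ line
  line-injective {L} {M} = decide (all? λ L → all? λ M → ≡-decᵛ _≟ᵇ_ (line L) (line M) →-dec L ≟ᶠ M) L M

∈-pointsOn⁻ : ∀ L {q} → q ∈ₗ pointsOn L → q ∈ line L
∈-pointsOn⁻ L q∈ = proj₂ (∈-filter⁻ (_∈? line L) {xs = allFin 13} q∈)

∈-pointsOn⁺ : ∀ L {q} → q ∈ line L → q ∈ₗ pointsOn L
∈-pointsOn⁺ L {q} = ∈-filter⁺ (_∈? line L) (∈-allFin q)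

word : Line → Line → Subset 13
word L₁ L₂ = line L₁ △ line L₂

-- Permutations acting on subsets and codes

lookup-extensional : ∀ {A : Set} {n} {u v : Vec A n} → (∀ i → lookup u i ≡ lookup v i) → u ≡ v
lookup-extensional {u = u} {v} eq =
  trans (sym (tabulate∘lookup u)) (trans (tabulate-cong eq) (tabulate∘lookup v))

lookup-image : ∀ σ s i → lookup (image σ s) i ≡ lookup s (σ ⟨$⟩ˡ i)
lookup-image σ s = lookup∘tabulate (λ i → lookup s (σ ⟨$⟩ˡ i))

∈-image⇔ : ∀ σ {s p} → σ ⟨$⟩ʳ p ∈ image σ s ⇔ p ∈ s
∈-image⇔ σ {s} {p} = mk⇔
  (λ σp∈ → lookup⇒[]= p s (trans (sym at-σp) ([]=⇒lookup σp∈)))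
  (λ p∈ → lookup⇒[]= (σ ⟨$⟩ʳ p) (image σ s) (trans at-σp ([]=⇒lookup p∈)))
  where
  at-σp : lookup (image σ s) (σ ⟨$⟩ʳ p) ≡ lookup s p
  at-σp = trans (lookup-image σ s (σ ⟨$⟩ʳ p)) (cong (lookup s) (inverseˡ σ))

∈-image⁻ : ∀ σ {s q} → q ∈ image σ s → σ ⟨$⟩ˡ q ∈ s
∈-image⁻ σ {s} q∈ = to (∈-image⇔ σ) (subst (_∈ image σ s) (sym (inverseʳ σ)) q∈)

image-zipWith : ∀ σ (f : Bool → Bool → Bool) s t →
  image σ (zipWith f s t) ≡ zipWith f (image σ s) (image σ t)
image-zipWith σ f s t = lookup-extensional λ i → begin
  lookup (image σ (zipWith f s t)) i             ≡⟨ lookup-image σ (zipWith f s t) i ⟩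
  lookup (zipWith f s t) (σ ⟨$⟩ˡ i)              ≡⟨ lookup-zipWith f _ s t ⟩
  f (lookup s (σ ⟨$⟩ˡ i)) (lookup t (σ ⟨$⟩ˡ i))  ≡⟨ cong₂ f (lookup-image σ s i) (lookup-image σ t i) ⟨
  f (lookup (image σ s) i) (lookup (image σ t) i) ≡⟨ lookup-zipWith f i (image σ s) (image σ t) ⟨
  lookup (zipWith f (image σ s) (image σ t)) i   ∎
  where open ≡-Reasoning

image-∁ : ∀ σ s → image σ (∁ s) ≡ ∁ (image σ s)
image-∁ σ s = lookup-extensional λ i → begin
  lookup (image σ (∁ s)) i    ≡⟨ lookup-image σ (∁ s) i ⟩
  lookup (∁ s) (σ ⟨$⟩ˡ i)     ≡⟨ lookup-map _ not s ⟩
  not (lookup s (σ ⟨$⟩ˡ i))   ≡⟨ cong not (lookup-image σ s i) ⟨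
  not (lookup (image σ s) i)  ≡⟨ lookup-map i not (image σ s) ⟨
  lookup (∁ (image σ s)) i    ∎
  where open ≡-Reasoning

image-⁅⁆ : ∀ σ x → image σ ⁅ x ⁆ ≡ ⁅ σ ⟨$⟩ʳ x ⁆
image-⁅⁆ σ x = ⊆-antisym
  (λ q∈ → subst (_∈ ⁅ σ ⟨$⟩ʳ x ⁆)
     (sym (trans (sym (inverseʳ σ)) (cong (σ ⟨$⟩ʳ_) (x∈⁅y⁆⇒x≡y x (∈-image⁻ σ q∈))))) (x∈⁅x⁆ _))
  (λ q∈ → subst (_∈ image σ ⁅ x ⁆) (sym (x∈⁅y⁆⇒x≡y _ q∈)) (from (∈-image⇔ σ) (x∈⁅x⁆ x)))

image-─ : ∀ σ s x → image σ (s - x) ≡ image σ s - (σ ⟨$⟩ʳ x)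
image-─ σ s x = trans (image-zipWith σ _ s ⁅ x ⁆) (cong (image σ s ─_) (image-⁅⁆ σ x))

image-∘ₚ : ∀ π₁ π₂ s → image (π₁ ∘ₚ π₂) s ≡ image π₂ (image π₁ s)
image-∘ₚ π₁ π₂ s = lookup-extensional λ i →
  trans (lookup-image (π₁ ∘ₚ π₂) s i)
        (sym (trans (lookup-image π₂ (image π₁ s) i) (lookup-image π₁ s _)))

image-flip-image : ∀ σ s → image σ (image (flip σ) s) ≡ s
image-flip-image σ s = lookup-extensional λ i →
  trans (lookup-image σ (image (flip σ) s) i) (trans (lookup-image (flip σ) s _) (cong (lookup s) (inverseʳ σ)))

image-image-flip : ∀ σ s → image (flip σ) (image σ s) ≡ s
image-image-flip σ = image-flip-image (flip σ)

image-injective : ∀ σ → Injective _≡_ _≡_ (image σ)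
image-injective σ {s} {t} eq =
  trans (sym (image-image-flip σ s)) (trans (cong (image (flip σ)) eq) (image-image-flip σ t))

module _ {C : Code} where

  InAut-∘ₚ : ∀ π₁ π₂ → InAut C π₁ → InAut C π₂ → InAut C (π₁ ∘ₚ π₂)
  InAut-∘ₚ π₁ π₂ aut₁ aut₂ s = subst (λ t → C s ⇔ C t) (sym (image-∘ₚ π₁ π₂ s)) (aut₂ _ ⇔-∘ aut₁ s)

  InAut-flip : ∀ σ → InAut C σ → InAut C (flip σ)
  InAut-flip σ aut s =
    subst (λ t → C t ⇔ C (image (flip σ) s)) (image-flip-image σ s) (⇔-sym (aut (image (flip σ) s)))

  transitive-from : ∀ (P : Code) base →
    (∀ s → P s → ∃[ g ] InAut C g × image g base ≡ s) →
    ∀ s s' → P s → P s' → ∃[ g ] InAut C g × image g s ≡ s'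
  transitive-from P base reach s s' Ps Ps' with reach s Ps | reach s' Ps'
  ... | g , aut-g , gb≡s | g' , aut-g' , g'b≡s' =
    flip g ∘ₚ g' , InAut-∘ₚ (flip g) g' (InAut-flip g aut-g) aut-g' , (begin
      image (flip g ∘ₚ g') s               ≡⟨ image-∘ₚ (flip g) g' s ⟩
      image g' (image (flip g) s)          ≡⟨ cong (image g' ∘ image (flip g)) gb≡s ⟨
      image g' (image (flip g) (image g base)) ≡⟨ cong (image g') (image-image-flip g base) ⟩
      image g' base                        ≡⟨ g'b≡s' ⟩
      s'                                   ∎)
    where open ≡-Reasoning

-- Collineations

Collineation : Permutation′ 13 → Set
Collineation σ = ∀ L → ∃[ M ] ∀ {p} → p ∈ line L → σ ⟨$⟩ʳ p ∈ line M

module Collineation-properties (σ : Permutation′ 13) (σ-coll : Collineation σ) where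

  private
    f : Ω → Ω
    f = σ ⟨$⟩ʳ_

    f-injective : Injective _≡_ _≡_ f
    f-injective {p} {q} fp≡fq = trans (sym (inverseˡ σ)) (trans (cong (σ ⟨$⟩ˡ_) fp≡fq) (inverseˡ σ))

  lineMap : Line → Line
  lineMap L = proj₁ (σ-coll L)

  -- σ maps the four points of L into the four points of lineMap L, so a fifth
  -- point cannot follow them.
  ∈-lineMap⇔ : ∀ L p → p ∈ line L ⇔ f p ∈ line (lineMap L)
  ∈-lineMap⇔ L p = mk⇔ (proj₂ (σ-coll L)) λ fp∈M → decidable-stable (p ∈? line L) λ p∉L →
    1+n≰n (subst₂ _≤_ (cong suc (length-pointsOn L)) (length-pointsOn (lineMap L))
      (length-≤-injection f (unique p∉L) f-injective (into fp∈M)))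
    where
    unique : p ∉ line L → Unique (p ∷ pointsOn L)
    unique p∉L = All.tabulate (λ q∈ p≡q → p∉L (subst (_∈ line L) (sym p≡q) (∈-pointsOn⁻ L q∈)))
               ∷ Unique-filter⁺ (_∈? line L) (allFin⁺ 13)
    into : f p ∈ line (lineMap L) → ∀ {q} → q ∈ₗ p ∷ pointsOn L → f q ∈ₗ pointsOn (lineMap L)
    into fp∈M (here refl) = ∈-pointsOn⁺ (lineMap L) fp∈M
    into fp∈M (there q∈)  = ∈-pointsOn⁺ (lineMap L) (proj₂ (σ-coll L) (∈-pointsOn⁻ L q∈))

  lineMap-injective : Injective _≡_ _≡_ lineMap
  lineMap-injective {L} {L'} eq = line-injective (⊆-antisym
    (λ {p} p∈ → from (∈-lineMap⇔ L' p) (subst (λ M → f p ∈ line M) eq (to (∈-lineMap⇔ L p) p∈)))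
    (λ {p} p∈ → from (∈-lineMap⇔ L p) (subst (λ M → f p ∈ line M) (sym eq) (to (∈-lineMap⇔ L' p) p∈))))

  lineMap-surjective : ∀ M → ∃[ L ] lineMap L ≡ M
  lineMap-surjective = injective⇒surjective lineMap-injective

  image-line : ∀ L → image σ (line L) ≡ line (lineMap L)
  image-line L = ⊆-antisym
    (λ {q} q∈ → subst (_∈ line (lineMap L)) (inverseʳ σ) (to (∈-lineMap⇔ L (σ ⟨$⟩ˡ q)) (∈-image⁻ σ q∈)))
    (λ {q} q∈ → subst (_∈ image σ (line L)) (inverseʳ σ) (from (∈-image⇔ σ)
      (from (∈-lineMap⇔ L (σ ⟨$⟩ˡ q)) (subst (_∈ line (lineMap L)) (sym (inverseʳ σ)) q∈))))

  image-word : ∀ L₁ L₂ → image σ (word L₁ L₂) ≡ word (lineMap L₁) (lineMap L₂)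
  image-word L₁ L₂ =
    trans (image-zipWith σ _xor_ (line L₁) (line L₂)) (cong₂ _△_ (image-line L₁) (image-line L₂))

  lineMap-join : ∀ {x y} → x ≢ y → lineMap (join x y) ≡ join (f x) (f y)
  lineMap-join {x} {y} x≢y = join-unique (x≢y ∘ f-injective)
    (to (∈-lineMap⇔ (join x y) x) (proj₁ (∈-join x y))) (to (∈-lineMap⇔ (join x y) y) (proj₂ (∈-join x y)))

  collinear⇔ : ∀ {x y z} → Collinear x y z ⇔ Collinear (f x) (f y) (f z)
  collinear⇔ {x} {y} {z} = mk⇔
    (λ (L , x∈ , y∈ , z∈) →
      lineMap L , to (∈-lineMap⇔ L x) x∈ , to (∈-lineMap⇔ L y) y∈ , to (∈-lineMap⇔ L z) z∈)
    (λ (M , fx∈ , fy∈ , fz∈) → let L , L↦M = lineMap-surjective M in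
      L , from (∈-lineMap⇔ L x) (toward L↦M fx∈) , from (∈-lineMap⇔ L y) (toward L↦M fy∈)
        , from (∈-lineMap⇔ L z) (toward L↦M fz∈))
    where
    toward : ∀ {L M q} → lineMap L ≡ M → q ∈ line M → q ∈ line (lineMap L)
    toward {q = q} L↦M = subst (λ N → q ∈ line N) (sym L↦M)

  frame⇔ : ∀ {a b c d} → Frame a b c d ⇔ Frame (f a) (f b) (f c) (f d)
  frame⇔ = mk⇔
    (λ (frame abc abd acd bcd) →
      frame (abc ∘ from collinear⇔) (abd ∘ from collinear⇔) (acd ∘ from collinear⇔) (bcd ∘ from collinear⇔))
    (λ (frame abc abd acd bcd) →
      frame (abc ∘ to collinear⇔) (abd ∘ to collinear⇔) (acd ∘ to collinear⇔) (bcd ∘ to collinear⇔))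

  preserves-LineCode : InAut LineCode σ
  preserves-LineCode s = mk⇔ forward backward
    where
    forward : LineCode s → LineCode (image σ s)
    forward (L₁ , L₂ , L₁≢L₂ , refl) =
      lineMap L₁ , lineMap L₂ , L₁≢L₂ ∘ lineMap-injective , image-word L₁ L₂

    backward : LineCode (image σ s) → LineCode s
    backward (M₁ , M₂ , M₁≢M₂ , σs≡) =
      let L₁ , L₁↦M₁ = lineMap-surjective M₁
          L₂ , L₂↦M₂ = lineMap-surjective M₂
      in L₁ , L₂ , (λ L₁≡L₂ → M₁≢M₂ (trans (sym L₁↦M₁) (trans (cong lineMap L₁≡L₂) L₂↦M₂)))
         , image-injective σ (trans σs≡ (sym (trans (image-word L₁ L₂) (cong₂ word L₁↦M₁ L₂↦M₂))))


-- Linear algebra over F₃ and PΓL₃(3)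

_⊗_ : Mat → Mat → Mat
(A ⊗ B) i j = dot (A i) (λ k → B k j)

dot-linear : ∀ n u v α β → dot n (λ k → α * u k + β * v k) ≡ α * dot n u + β * dot n v
dot-linear n u v α β = solve-∀′ (n zero) (n (suc zero)) (n (suc (suc zero)))
  (u zero) (u (suc zero)) (u (suc (suc zero))) (v zero) (v (suc zero)) (v (suc (suc zero))) α β
  where
  solve-∀′ : ∀ n₀ n₁ n₂ u₀ u₁ u₂ v₀ v₁ v₂ α β →
    n₀ * (α * u₀ + β * v₀) + n₁ * (α * u₁ + β * v₁) + n₂ * (α * u₂ + β * v₂)
      ≡ α * (n₀ * u₀ + n₁ * u₁ + n₂ * u₂) + β * (n₀ * v₀ + n₁ * v₁ + n₂ * v₂)
  solve-∀′ = solve-∀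

dot-scale : ∀ n c u → dot n (λ k → c * u k) ≡ c * dot n u
dot-scale n c u = solve-∀′ (n zero) (n (suc zero)) (n (suc (suc zero))) c (u zero) (u (suc zero)) (u (suc (suc zero)))
  where
  solve-∀′ : ∀ n₀ n₁ n₂ c u₀ u₁ u₂ →
    n₀ * (c * u₀) + n₁ * (c * u₁) + n₂ * (c * u₂) ≡ c * (n₀ * u₀ + n₁ * u₁ + n₂ * u₂)
  solve-∀′ = solve-∀

dot-cong₃ : ∀ n u v → (∀ k → u k ≈₃ v k) → dot n u ≈₃ dot n v
dot-cong₃ n u v u≈v = +-cong₃ (+-cong₃ (*-cong₃ (≈₃-refl {n zero}) (u≈v zero))
                                  (*-cong₃ (≈₃-refl {n (suc zero)}) (u≈v (suc zero))))
                          (*-cong₃ (≈₃-refl {n (suc (suc zero))}) (u≈v (suc (suc zero))))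

·-⊗ : ∀ A B v i → ((A ⊗ B) · v) i ≡ (A · (B · v)) i
·-⊗ A B v i = solve-∀′ (A i zero) (A i (suc zero)) (A i (suc (suc zero)))
  (B zero zero) (B zero (suc zero)) (B zero (suc (suc zero)))
  (B (suc zero) zero) (B (suc zero) (suc zero)) (B (suc zero) (suc (suc zero)))
  (B (suc (suc zero)) zero) (B (suc (suc zero)) (suc zero)) (B (suc (suc zero)) (suc (suc zero)))
  (v zero) (v (suc zero)) (v (suc (suc zero)))
  where
  solve-∀′ : ∀ a₀ a₁ a₂ b₀₀ b₀₁ b₀₂ b₁₀ b₁₁ b₁₂ b₂₀ b₂₁ b₂₂ v₀ v₁ v₂ →
    (a₀ * b₀₀ + a₁ * b₁₀ + a₂ * b₂₀) * v₀ + (a₀ * b₀₁ + a₁ * b₁₁ + a₂ * b₂₁) * v₁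
      + (a₀ * b₀₂ + a₁ * b₁₂ + a₂ * b₂₂) * v₂
    ≡ a₀ * (b₀₀ * v₀ + b₀₁ * v₁ + b₀₂ * v₂) + a₁ * (b₁₀ * v₀ + b₁₁ * v₁ + b₁₂ * v₂)
      + a₂ * (b₂₀ * v₀ + b₂₁ * v₁ + b₂₂ * v₂)
  solve-∀′ = solve-∀

-- det (A ⊗ B) = det A · det B, with both determinants split as detPos − detNeg
-- and all subtractions moved across (a semiring identity).
det-⊗ : ∀ A B → detPos (A ⊗ B) + (detPos A * detNeg B + detNeg A * detPos B)
              ≡ detNeg (A ⊗ B) + (detPos A * detPos B + detNeg A * detNeg B)
det-⊗ A B = solve-∀′
  (A zero zero) (A zero (suc zero)) (A zero (suc (suc zero)))
  (A (suc zero) zero) (A (suc zero) (suc zero)) (A (suc zero) (suc (suc zero)))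
  (A (suc (suc zero)) zero) (A (suc (suc zero)) (suc zero)) (A (suc (suc zero)) (suc (suc zero)))
  (B zero zero) (B zero (suc zero)) (B zero (suc (suc zero)))
  (B (suc zero) zero) (B (suc zero) (suc zero)) (B (suc zero) (suc (suc zero)))
  (B (suc (suc zero)) zero) (B (suc (suc zero)) (suc zero)) (B (suc (suc zero)) (suc (suc zero)))
  where
  solve-∀′ : ∀ a₀₀ a₀₁ a₀₂ a₁₀ a₁₁ a₁₂ a₂₀ a₂₁ a₂₂ b₀₀ b₀₁ b₀₂ b₁₀ b₁₁ b₁₂ b₂₀ b₂₁ b₂₂ →
    (a₀₀ * b₀₀ + a₀₁ * b₁₀ + a₀₂ * b₂₀) * (a₁₀ * b₀₁ + a₁₁ * b₁₁ + a₁₂ * b₂₁) * (a₂₀ * b₀₂ + a₂₁ * b₁₂ + a₂₂ * b₂₂)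
    + (a₀₀ * b₀₁ + a₀₁ * b₁₁ + a₀₂ * b₂₁) * (a₁₀ * b₀₂ + a₁₁ * b₁₂ + a₁₂ * b₂₂) * (a₂₀ * b₀₀ + a₂₁ * b₁₀ + a₂₂ * b₂₀)
    + (a₀₀ * b₀₂ + a₀₁ * b₁₂ + a₀₂ * b₂₂) * (a₁₀ * b₀₀ + a₁₁ * b₁₀ + a₁₂ * b₂₀) * (a₂₀ * b₀₁ + a₂₁ * b₁₁ + a₂₂ * b₂₁)
    + ((a₀₀ * a₁₁ * a₂₂ + a₀₁ * a₁₂ * a₂₀ + a₀₂ * a₁₀ * a₂₁) * (b₀₂ * b₁₁ * b₂₀ + b₀₀ * b₁₂ * b₂₁ + b₀₁ * b₁₀ * b₂₂)
      + (a₀₂ * a₁₁ * a₂₀ + a₀₀ * a₁₂ * a₂₁ + a₀₁ * a₁₀ * a₂₂) * (b₀₀ * b₁₁ * b₂₂ + b₀₁ * b₁₂ * b₂₀ + b₀₂ * b₁₀ * b₂₁))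
    ≡ (a₀₀ * b₀₂ + a₀₁ * b₁₂ + a₀₂ * b₂₂) * (a₁₀ * b₀₁ + a₁₁ * b₁₁ + a₁₂ * b₂₁) * (a₂₀ * b₀₀ + a₂₁ * b₁₀ + a₂₂ * b₂₀)
    + (a₀₀ * b₀₀ + a₀₁ * b₁₀ + a₀₂ * b₂₀) * (a₁₀ * b₀₂ + a₁₁ * b₁₂ + a₁₂ * b₂₂) * (a₂₀ * b₀₁ + a₂₁ * b₁₁ + a₂₂ * b₂₁)
    + (a₀₀ * b₀₁ + a₀₁ * b₁₁ + a₀₂ * b₂₁) * (a₁₀ * b₀₀ + a₁₁ * b₁₀ + a₁₂ * b₂₀) * (a₂₀ * b₀₂ + a₂₁ * b₁₂ + a₂₂ * b₂₂)
    + ((a₀₀ * a₁₁ * a₂₂ + a₀₁ * a₁₂ * a₂₀ + a₀₂ * a₁₀ * a₂₁) * (b₀₀ * b₁₁ * b₂₂ + b₀₁ * b₁₂ * b₂₀ + b₀₂ * b₁₀ * b₂₁)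
      + (a₀₂ * a₁₁ * a₂₀ + a₀₀ * a₁₂ * a₂₁ + a₀₁ * a₁₀ * a₂₂) * (b₀₂ * b₁₁ * b₂₀ + b₀₀ * b₁₂ * b₂₁ + b₀₁ * b₁₀ * b₂₂))
  solve-∀′ = solve-∀

Invertible-⊗ : ∀ A B → Invertible₃ A → Invertible₃ B → Invertible₃ (A ⊗ B)
Invertible-⊗ A B detA≢0 detB≢0 detAB≡0 = F₃-difference-product (residue P) (residue N) (residue P′) (residue N′)
  (detA≢0 ∘ lift P N) (detB≢0 ∘ lift P′ N′) (unmod₃ cross)
  where
  P = detPos A
  N = detNeg A
  P′ = detPos B
  N′ = detNeg B
  open SetoidReasoning ≈₃-setoid
  detAB≈ : detPos (A ⊗ B) ≈₃ detNeg (A ⊗ B)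
  detAB≈ = mod₃ detAB≡0
  lift : ∀ m n → ⟦ m ⟧ ≡₃ ⟦ n ⟧ → m ≡₃ n
  lift m n r≡s = unmod₃ (≈₃-trans (≈₃-sym (toℕ-residue m)) (≈₃-trans (mod₃ r≡s) (toℕ-residue n)))
  cross : ⟦ P ⟧ * ⟦ N′ ⟧ + ⟦ N ⟧ * ⟦ P′ ⟧ ≈₃ ⟦ P ⟧ * ⟦ P′ ⟧ + ⟦ N ⟧ * ⟦ N′ ⟧
  cross = begin
    ⟦ P ⟧ * ⟦ N′ ⟧ + ⟦ N ⟧ * ⟦ P′ ⟧
      ≈⟨ +-cong₃ (*-cong₃ (toℕ-residue P) (toℕ-residue N′)) (*-cong₃ (toℕ-residue N) (toℕ-residue P′)) ⟩
    P * N′ + N * P′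
      ≈⟨ +-cancelˡ₃ detAB≈ (≡⇒≈₃ (det-⊗ A B)) ⟩
    P * P′ + N * N′
      ≈⟨ +-cong₃ (*-cong₃ (toℕ-residue P) (toℕ-residue P′)) (*-cong₃ (toℕ-residue N) (toℕ-residue N′)) ⟨
    ⟦ P ⟧ * ⟦ P′ ⟧ + ⟦ N ⟧ * ⟦ N′ ⟧ ∎

PΓL-∘ₚ : ∀ π₁ π₂ → InPΓL₃3 π₁ → InPΓL₃3 π₂ → InPΓL₃3 (π₁ ∘ₚ π₂)
PΓL-∘ₚ π₁ π₂ (A₁ , A₁-inv , H₁) (A₂ , A₂-inv , H₂) =
  A₂ ⊗ A₁ , Invertible-⊗ A₂ A₁ A₂-inv A₁-inv , same-point
  where
  same-point : ∀ p → SamePoint ((A₂ ⊗ A₁) · pt p) (pt (π₂ ⟨$⟩ʳ (π₁ ⟨$⟩ʳ p)))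
  same-point p =
    let c₁ , c₁≢0 , h₁ = H₁ p
        c₂ , c₂≢0 , h₂ = H₂ q
        open SetoidReasoning ≈₃-setoid
    in c₁ * c₂ , *-nonzero₃ {c₁} {c₂} (c₁≢0 ∘ unmod₃) (c₂≢0 ∘ unmod₃) ∘ mod₃ , λ i → unmod₃ (begin
      ((A₂ ⊗ A₁) · pt p) i             ≡⟨ ·-⊗ A₂ A₁ (pt p) i ⟩
      dot (A₂ i) (A₁ · pt p)           ≈⟨ dot-cong₃ (A₂ i) (A₁ · pt p) (λ k → c₁ * pt q k) (mod₃ ∘ h₁) ⟩
      dot (A₂ i) (λ k → c₁ * pt q k)   ≡⟨ dot-scale (A₂ i) c₁ (pt q) ⟩
      c₁ * (A₂ · pt q) i               ≈⟨ *-cong₃ (≈₃-refl {c₁}) (mod₃ (h₂ i)) ⟩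
      c₁ * (c₂ * pt r i)               ≡⟨ *-assoc c₁ c₂ (pt r i) ⟨
      c₁ * c₂ * pt r i                 ∎)
    where
    q = π₁ ⟨$⟩ʳ p
    r = π₂ ⟨$⟩ʳ q

-- With n the normal vector of M, x ↦ n · (A x) is a linear form vanishing at the two
-- spanning points of L, hence at every point of L.
PΓL⇒collineation : ∀ σ → InPΓL₃3 σ → Collineation σ
PΓL⇒collineation σ (A , _ , H) L = join (f a) (f b) , λ {p} p∈L →
  follows {join (f a) (f b)} {p} p∈L (proj₁ (∈-join (f a) (f b))) (proj₂ (∈-join (f a) (f b)))
  where
  open SetoidReasoning ≈₃-setoid
  f : Ω → Ω
  f = σ ⟨$⟩ʳ_
  a = firstPoint L
  b = secondPoint L

  vanishes : ∀ M q → f q ∈ line M → dot (pt M) (A · pt q) ≈₃ 0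
  vanishes M q fq∈M = let c , _ , h = H q in begin
    dot (pt M) (A · pt q)             ≈⟨ dot-cong₃ (pt M) (A · pt q) (λ k → c * pt (f q) k) (mod₃ ∘ h) ⟩
    dot (pt M) (λ k → c * pt (f q) k) ≡⟨ dot-scale (pt M) c (pt (f q)) ⟩
    c * dot (pt M) (pt (f q))         ≈⟨ *-cong₃ (≈₃-refl {c}) (to (∈-line⇔ M (f q)) fq∈M) ⟩
    c * 0                             ≡⟨ *-zeroʳ c ⟩
    0                                 ∎

  follows : ∀ {M p} → p ∈ line L → f a ∈ line M → f b ∈ line M → f p ∈ line M
  follows {M} {p} p∈L fa∈M fb∈M =
    let α , β , p≈αa+βb = spanned-by-two-points {L} {p} p∈L
        c , c≢0 , h = H p
        n = pt M
        α′ = toℕ α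
        β′ = toℕ β
        u = A · pt a
        v = A · pt b
    in from (∈-line⇔ M (f p)) (*-cancelˡ₃ {c} (c≢0 ∘ unmod₃) (begin
      c * dot n (pt (f p))
        ≡⟨ dot-scale n c (pt (f p)) ⟨
      dot n (λ k → c * pt (f p) k)
        ≈⟨ dot-cong₃ n (A · pt p) (λ k → c * pt (f p) k) (mod₃ ∘ h) ⟨
      dot n (A · pt p)
        ≈⟨ dot-cong₃ n (A · pt p) (λ i → α′ * u i + β′ * v i) (λ i → ≈₃-trans
             (dot-cong₃ (A i) (pt p) (λ k → α′ * pt a k + β′ * pt b k) (mod₃ ∘ p≈αa+βb))
             (≡⇒≈₃ (dot-linear (A i) (pt a) (pt b) α′ β′))) ⟩
      dot n (λ i → α′ * u i + β′ * v i)
        ≡⟨ dot-linear n u v α′ β′ ⟩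
      α′ * dot n u + β′ * dot n v
        ≈⟨ +-cong₃ (*-cong₃ (≈₃-refl {α′}) (vanishes M a fa∈M)) (*-cong₃ (≈₃-refl {β′}) (vanishes M b fb∈M)) ⟩
      α′ * 0 + β′ * 0
        ≡⟨ cong₂ _+_ (*-zeroʳ α′) (*-zeroʳ β′) ⟩
      0 ∎))


-- The code C

linePairs : List (Line × Line)
linePairs = filter (uncurry _<?_) (cartesianProduct (allFin 13) (allFin 13))

codewords : List (Subset 13)
codewords = List.map (uncurry word) linePairs

word-comm : ∀ L₁ L₂ → word L₁ L₂ ≡ word L₂ L₁
word-comm L₁ L₂ = zipWith-comm xor-comm (line L₁) (line L₂)

∈-codewords⇔ : ∀ s → LineCode s ⇔ s ∈ₗ codewords
∈-codewords⇔ s = mk⇔ into out-of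
  where
  listed : ∀ {L₁ L₂} → L₁ Fin.< L₂ → word L₁ L₂ ∈ₗ codewords
  listed {L₁} {L₂} L₁<L₂ = ∈-map⁺ (uncurry word)
    (∈-filter⁺ (uncurry _<?_) (∈-cartesianProduct⁺ (∈-allFin L₁) (∈-allFin L₂)) L₁<L₂)

  into : LineCode s → s ∈ₗ codewords
  into (L₁ , L₂ , L₁≢L₂ , refl) with <-cmp L₁ L₂
  ... | tri< L₁<L₂ _ _ = listed L₁<L₂
  ... | tri≈ _ L₁≡L₂ _ = ⊥-elim (L₁≢L₂ L₁≡L₂)
  ... | tri> _ _ L₂<L₁ = subst (_∈ₗ codewords) (word-comm L₂ L₁) (listed L₂<L₁)

  out-of : s ∈ₗ codewords → LineCode s
  out-of s∈ =
    let (L₁ , L₂) , pair∈ , s≡ = ∈-map⁻ (uncurry word) {xs = linePairs} s∈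
    in L₁ , L₂ , <⇒≢ (proj₂ (∈-filter⁻ (uncurry _<?_) {xs = cartesianProduct (allFin 13) (allFin 13)} pair∈))
       , s≡

abstract
  codewords-unique : Unique codewords
  codewords-unique = decide (unique? codewords)

codewordsThrough : Ω → Ω → Ω → List (Subset 13)
codewordsThrough x y z = filter (λ w → x ∈? w ×-dec y ∈? w ×-dec z ∈? w) codewords

-- Three distinct points lie in exactly three codewords if they are collinear and in six otherwise.
Collinear⇔≤3-codewords : Ω → Ω → Ω → Set
Collinear⇔≤3-codewords x y z = Collinear x y z ⇔ length (codewordsThrough x y z) ≤ 3

abstract
  collinear⇔≤3-codewords< : ∀ {x y z} → x Fin.< y → y Fin.< z → Collinear⇔≤3-codewords x y z
  collinear⇔≤3-codewords< {x} {y} {z} x<y y<z = mk⇔ (proj₁ (checked x y z x<y y<z)) (proj₂ (checked x y z x<y y<z))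
    where
    checked : ∀ x y z → x Fin.< y → y Fin.< z →
      (Collinear x y z → length (codewordsThrough x y z) ≤ 3) × (length (codewordsThrough x y z) ≤ 3 → Collinear x y z)
    checked = decide (all? λ x → all? λ y → all? λ z → x <? y →-dec y <? z →-dec
      (collinear? x y z →-dec length (codewordsThrough x y z) ≤? 3) ×-dec
      (length (codewordsThrough x y z) ≤? 3 →-dec collinear? x y z))

swap₁₂ : ∀ {x y z} → Collinear⇔≤3-codewords x y z → Collinear⇔≤3-codewords y x z
swap₁₂ {x} {y} {z} criterion = mk⇔
  (λ (L , y∈ , x∈ , z∈) → subst (_≤ 3) (cong length same) (to criterion (L , x∈ , y∈ , z∈)))
  (λ few → let L , x∈ , y∈ , z∈ = from criterion (subst (_≤ 3) (cong length (sym same)) few) in L , y∈ , x∈ , z∈)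
  where
  same : codewordsThrough x y z ≡ codewordsThrough y x z
  same = filter-≐ (λ w → x ∈? w ×-dec y ∈? w ×-dec z ∈? w) (λ w → y ∈? w ×-dec x ∈? w ×-dec z ∈? w)
    ((λ (p , q , r) → q , p , r) , (λ (p , q , r) → q , p , r)) codewords

swap₂₃ : ∀ {x y z} → Collinear⇔≤3-codewords x y z → Collinear⇔≤3-codewords x z y
swap₂₃ {x} {y} {z} criterion = mk⇔
  (λ (L , x∈ , z∈ , y∈) → subst (_≤ 3) (cong length same) (to criterion (L , x∈ , y∈ , z∈)))
  (λ few → let L , x∈ , y∈ , z∈ = from criterion (subst (_≤ 3) (cong length (sym same)) few) in L , x∈ , z∈ , y∈)
  where
  same : codewordsThrough x y z ≡ codewordsThrough x z y
  same = filter-≐ (λ w → x ∈? w ×-dec y ∈? w ×-dec z ∈? w) (λ w → x ∈? w ×-dec z ∈? w ×-dec y ∈? w)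
    ((λ (p , q , r) → p , r , q) , (λ (p , q , r) → p , r , q)) codewords

-- Both sides are symmetric in x, y, z, so sorting the points reduces to the checked case.
collinear⇔≤3-codewords : ∀ {x y z} → x ≢ y → x ≢ z → y ≢ z → Collinear⇔≤3-codewords x y z
collinear⇔≤3-codewords {x} {y} {z} x≢y x≢z y≢z = sorted (<-cmp x y) (<-cmp y z) (<-cmp x z)
  where
  sorted : Tri (x Fin.< y) (x ≡ y) (y Fin.< x) → Tri (y Fin.< z) (y ≡ z) (z Fin.< y) → Tri (x Fin.< z) (x ≡ z) (z Fin.< x) →
           Collinear⇔≤3-codewords x y z
  sorted (tri≈ _ x≡y _) _ _ = ⊥-elim (x≢y x≡y)
  sorted _ (tri≈ _ y≡z _) _ = ⊥-elim (y≢z y≡z)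
  sorted _ _ (tri≈ _ x≡z _) = ⊥-elim (x≢z x≡z)
  sorted (tri< x<y _ _) (tri< y<z _ _) _              = collinear⇔≤3-codewords< x<y y<z
  sorted (tri< x<y _ _) (tri> _ _ z<y) (tri< x<z _ _) = swap₂₃ (collinear⇔≤3-codewords< x<z z<y)
  sorted (tri< x<y _ _) (tri> _ _ z<y) (tri> _ _ z<x) = swap₂₃ (swap₁₂ (collinear⇔≤3-codewords< z<x x<y))
  sorted (tri> _ _ y<x) (tri< y<z _ _) (tri< x<z _ _) = swap₁₂ (collinear⇔≤3-codewords< y<x x<z)
  sorted (tri> _ _ y<x) (tri< y<z _ _) (tri> _ _ z<x) = swap₁₂ (swap₂₃ (collinear⇔≤3-codewords< y<z z<x))
  sorted (tri> _ _ y<x) (tri> _ _ z<y) _              = swap₁₂ (swap₂₃ (swap₁₂ (collinear⇔≤3-codewords< z<y y<x)))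

module _ (σ : Permutation′ 13) (aut : InAut LineCode σ) where

  private
    f : Ω → Ω
    f = σ ⟨$⟩ʳ_

    f-injective : ∀ {p q} → f p ≡ f q → p ≡ q
    f-injective {p} {q} fp≡fq = trans (sym (inverseˡ σ)) (trans (cong (σ ⟨$⟩ˡ_) fp≡fq) (inverseˡ σ))

  -- σ⁻¹ maps the codewords through f x, f y, f z injectively to codewords through x, y, z.
  length-codewordsThrough-≤ : ∀ x y z →
    length (codewordsThrough (f x) (f y) (f z)) ≤ length (codewordsThrough x y z)
  length-codewordsThrough-≤ x y z = length-≤-injection (image (flip σ))
    (Unique-filter⁺ (λ w → f x ∈? w ×-dec f y ∈? w ×-dec f z ∈? w) codewords-unique)
    (image-injective (flip σ)) pulled-back
    where
    pulled-back : ∀ {w} → w ∈ₗ codewordsThrough (f x) (f y) (f z) → image (flip σ) w ∈ₗ codewordsThrough x y z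
    pulled-back {w} w∈ =
      let w∈C , fx∈w , fy∈w , fz∈w = ∈-filter⁻ (λ w → f x ∈? w ×-dec f y ∈? w ×-dec f z ∈? w) {xs = codewords} w∈
          back : ∀ {p} → f p ∈ w → p ∈ image (flip σ) w
          back {p} fp∈w = subst (_∈ image (flip σ) w) (inverseˡ σ) (from (∈-image⇔ (flip σ)) fp∈w)
          code : LineCode (image (flip σ) w)
          code = from (aut (image (flip σ) w))
                   (subst LineCode (sym (image-flip-image σ w)) (from (∈-codewords⇔ w) w∈C))
      in ∈-filter⁺ (λ v → x ∈? v ×-dec y ∈? v ×-dec z ∈? v) (to (∈-codewords⇔ _) code)
           (back fx∈w , back fy∈w , back fz∈w)

  collinear-image : ∀ {x y z} → x ≢ y → x ≢ z → y ≢ z → Collinear x y z → Collinear (f x) (f y) (f z)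
  collinear-image {x} {y} {z} x≢y x≢z y≢z xyz =
    from (collinear⇔≤3-codewords (x≢y ∘ f-injective) (x≢z ∘ f-injective) (y≢z ∘ f-injective))
      (≤-trans (length-codewordsThrough-≤ x y z) (to (collinear⇔≤3-codewords x≢y x≢z y≢z) xyz))

  aut⇒collineation : Collineation σ
  aut⇒collineation L = join (f a) (f b) , λ {p} p∈L → on-join p (p ≟ᶠ a) (p ≟ᶠ b) p∈L
    where
    a = firstPoint L
    b = secondPoint L

    on-join : ∀ p → Dec (p ≡ a) → Dec (p ≡ b) → p ∈ line L → f p ∈ line (join (f a) (f b))
    on-join p (yes refl) _          _   = proj₁ (∈-join (f a) (f b))
    on-join p (no _)     (yes refl) _   = proj₂ (∈-join (f a) (f b))
    on-join p (no p≢a)   (no p≢b)   p∈L =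
      let a≢b , a∈L , b∈L = two-points-on L
          M , fa∈M , fb∈M , fp∈M = collinear-image {a} {b} {p} a≢b (p≢a ∘ sym) (p≢b ∘ sym) (L , a∈L , b∈L , p∈L)
      in subst (λ N → f p ∈ line N) (join-unique {f a} {f b} {M} (a≢b ∘ f-injective) fa∈M fb∈M) fp∈M

-- Frames

samePoint? : ∀ (u v : V3) → Dec (Σ (Fin 3) λ c → ¬ toℕ c ≡₃ 0 × ∀ i → u i ≡₃ (toℕ c * v i))
samePoint? u v = any? λ c → ¬? (toℕ c ≡₃? 0) ×-dec all? λ i → u i ≡₃? (toℕ c * v i)

-- The point spanned by v (junk when v ≡ 0).
pointOf : V3 → Ω
pointOf v = first λ q → samePoint? v (pt q)

induced : Mat → Ω → Ω
induced A p = pointOf (A · pt p)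

preimage : (Ω → Ω) → Ω → Ω
preimage f q = first λ p → f p ≟ᶠ q

InducesPermutation : Mat → Set
InducesPermutation A =
  Invertible₃ A × (∀ q → induced A (preimage (induced A) q) ≡ q) × (∀ p → preimage (induced A) (induced A p) ≡ p)
  × ∀ p → Σ (Fin 3) λ c → ¬ toℕ c ≡₃ 0 × ∀ i → (A · pt p) i ≡₃ (toℕ c * pt (induced A p) i)

inducesPermutation? : ∀ A → Dec (InducesPermutation A)
inducesPermutation? A =
  ¬? (detPos A ≡₃? detNeg A) ×-dec (all? λ q → induced A (preimage (induced A) q) ≟ᶠ q)
  ×-dec (all? λ p → preimage (induced A) (induced A p) ≟ᶠ p)
  ×-dec (all? λ p → samePoint? (A · pt p) (pt (induced A p)))

matrixPermutation : ∀ A → InducesPermutation A → Permutation′ 13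
matrixPermutation A (_ , right , left , _) = permutation (induced A) (preimage (induced A)) right left

matrixPermutation-PΓL : ∀ A ok → InPΓL₃3 (matrixPermutation A ok)
matrixPermutation-PΓL A (A-inv , _ , _ , same) =
  A , A-inv , λ p → let c , c≢0 , h = same p in toℕ c , c≢0 , h

mat : ℕ → ℕ → ℕ → ℕ → ℕ → ℕ → ℕ → ℕ → ℕ → Mat
mat a b c d e f g h i zero             = v3 a b c
mat a b c d e f g h i (suc zero)       = v3 d e f
mat a b c d e f g h i (suc (suc zero)) = v3 g h i

-- A stabiliser chain of the standard frame 4, 1, 0, 8, i.e. of e₁, e₂, e₃, e₁+e₂+e₃.

R₁-matrices : Vec Mat 13
R₁-matrices = mat 0 1 0 0 0 1 1 0 0
  ∷ mat 0 1 0 1 0 0 0 0 1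
  ∷ mat 0 1 0 2 0 0 2 0 1
  ∷ mat 0 1 0 1 0 0 2 0 1
  ∷ mat 1 0 0 0 1 0 0 0 1
  ∷ mat 1 0 0 0 2 0 1 0 2
  ∷ mat 1 0 0 0 1 0 2 0 1
  ∷ mat 1 0 0 1 1 0 0 0 1
  ∷ mat 1 0 0 1 2 0 1 0 2
  ∷ mat 1 0 0 1 1 0 2 0 1
  ∷ mat 1 0 0 2 1 0 0 0 1
  ∷ mat 1 0 0 2 2 0 1 0 2
  ∷ mat 1 0 0 2 1 0 2 0 1
  ∷ []

R₂-matrices : Vec Mat 13
R₂-matrices = mat 1 0 0 0 0 1 0 1 0
  ∷ mat 1 0 0 0 1 0 0 0 1
  ∷ mat 1 0 0 0 2 0 0 2 1
  ∷ mat 1 0 0 0 1 0 0 2 1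
  ∷ mat 1 0 0 0 1 0 0 0 1
  ∷ mat 1 1 0 0 0 1 0 1 0
  ∷ mat 1 1 0 0 0 1 0 2 0
  ∷ mat 1 1 0 0 1 0 0 0 1
  ∷ mat 1 2 0 0 2 0 0 2 1
  ∷ mat 1 1 0 0 1 0 0 2 1
  ∷ mat 1 1 0 0 2 0 0 0 1
  ∷ mat 1 2 0 0 1 0 0 2 1
  ∷ mat 1 1 0 0 2 0 0 2 1
  ∷ []

R₃-matrices : Vec Mat 13
R₃-matrices = mat 1 0 0 0 1 0 0 0 1
  ∷ mat 1 0 0 0 1 0 0 0 1
  ∷ mat 1 0 0 0 2 1 0 0 1
  ∷ mat 1 0 0 0 2 1 0 0 2
  ∷ mat 1 0 0 0 1 0 0 0 1
  ∷ mat 1 0 2 0 2 0 0 0 2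
  ∷ mat 1 0 2 0 2 0 0 0 1
  ∷ mat 1 0 0 0 1 0 0 0 1
  ∷ mat 1 0 2 0 1 2 0 0 2
  ∷ mat 1 0 2 0 1 2 0 0 1
  ∷ mat 1 0 0 0 1 0 0 0 1
  ∷ mat 1 0 2 0 2 1 0 0 2
  ∷ mat 1 0 2 0 2 1 0 0 1
  ∷ []

R₄-matrices : Vec Mat 13
R₄-matrices = mat 1 0 0 0 1 0 0 0 1
  ∷ mat 1 0 0 0 1 0 0 0 1
  ∷ mat 1 0 0 0 1 0 0 0 1
  ∷ mat 1 0 0 0 1 0 0 0 1
  ∷ mat 1 0 0 0 1 0 0 0 1
  ∷ mat 1 0 0 0 1 0 0 0 1
  ∷ mat 1 0 0 0 1 0 0 0 1
  ∷ mat 1 0 0 0 1 0 0 0 1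
  ∷ mat 1 0 0 0 1 0 0 0 1
  ∷ mat 1 0 0 0 1 0 0 0 2
  ∷ mat 1 0 0 0 1 0 0 0 1
  ∷ mat 1 0 0 0 2 0 0 0 1
  ∷ mat 1 0 0 0 2 0 0 0 2
  ∷ []

abstract
  R₁-induces : ∀ a → InducesPermutation (lookup R₁-matrices a)
  R₁-induces = decide (all? λ a → inducesPermutation? (lookup R₁-matrices a))

  R₂-induces : ∀ b → InducesPermutation (lookup R₂-matrices b)
  R₂-induces = decide (all? λ b → inducesPermutation? (lookup R₂-matrices b))

  R₃-induces : ∀ c → InducesPermutation (lookup R₃-matrices c)
  R₃-induces = decide (all? λ c → inducesPermutation? (lookup R₃-matrices c))

  R₄-induces : ∀ d → InducesPermutation (lookup R₄-matrices d)
  R₄-induces = decide (all? λ d → inducesPermutation? (lookup R₄-matrices d))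

  R₁ R₂ R₃ R₄ : Ω → Permutation′ 13
  R₁ a = matrixPermutation (lookup R₁-matrices a) (R₁-induces a)
  R₂ b = matrixPermutation (lookup R₂-matrices b) (R₂-induces b)
  R₃ c = matrixPermutation (lookup R₃-matrices c) (R₃-induces c)
  R₄ d = matrixPermutation (lookup R₄-matrices d) (R₄-induces d)

  R₁-PΓL : ∀ a → InPΓL₃3 (R₁ a)
  R₁-PΓL a = matrixPermutation-PΓL (lookup R₁-matrices a) (R₁-induces a)

  R₂-PΓL : ∀ b → InPΓL₃3 (R₂ b)
  R₂-PΓL b = matrixPermutation-PΓL (lookup R₂-matrices b) (R₂-induces b)

  R₃-PΓL : ∀ c → InPΓL₃3 (R₃ c)
  R₃-PΓL c = matrixPermutation-PΓL (lookup R₃-matrices c) (R₃-induces c)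

  R₄-PΓL : ∀ d → InPΓL₃3 (R₄ d)
  R₄-PΓL d = matrixPermutation-PΓL (lookup R₄-matrices d) (R₄-induces d)

  R₁-maps : ∀ a → R₁ a ⟨$⟩ʳ # 4 ≡ a
  R₁-maps = decide (all? λ a → R₁ a ⟨$⟩ʳ # 4 ≟ᶠ a)

  R₂-maps : ∀ b → # 4 ≢ b → R₂ b ⟨$⟩ʳ # 4 ≡ # 4 × R₂ b ⟨$⟩ʳ # 1 ≡ b
  R₂-maps = decide (all? λ b → ¬? (# 4 ≟ᶠ b) →-dec (R₂ b ⟨$⟩ʳ # 4 ≟ᶠ # 4 ×-dec R₂ b ⟨$⟩ʳ # 1 ≟ᶠ b))

  R₃-maps : ∀ c → ¬ Collinear (# 4) (# 1) c →
    R₃ c ⟨$⟩ʳ # 4 ≡ # 4 × R₃ c ⟨$⟩ʳ # 1 ≡ # 1 × R₃ c ⟨$⟩ʳ # 0 ≡ c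
  R₃-maps = decide (all? λ c → ¬? (collinear? (# 4) (# 1) c) →-dec
    (R₃ c ⟨$⟩ʳ # 4 ≟ᶠ # 4 ×-dec R₃ c ⟨$⟩ʳ # 1 ≟ᶠ # 1 ×-dec R₃ c ⟨$⟩ʳ # 0 ≟ᶠ c))

  R₄-maps : ∀ d → Frame (# 4) (# 1) (# 0) d →
    R₄ d ⟨$⟩ʳ # 4 ≡ # 4 × R₄ d ⟨$⟩ʳ # 1 ≡ # 1 × R₄ d ⟨$⟩ʳ # 0 ≡ # 0 × R₄ d ⟨$⟩ʳ # 8 ≡ d
  R₄-maps = decide (all? λ d → frame? (# 4) (# 1) (# 0) d →-dec
    (R₄ d ⟨$⟩ʳ # 4 ≟ᶠ # 4 ×-dec R₄ d ⟨$⟩ʳ # 1 ≟ᶠ # 1 ×-dec R₄ d ⟨$⟩ʳ # 0 ≟ᶠ # 0 ×-dec R₄ d ⟨$⟩ʳ # 8 ≟ᶠ d))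

  standard-frame : Frame (# 4) (# 1) (# 0) (# 8)
  standard-frame = decide (frame? (# 4) (# 1) (# 0) (# 8))

MapsStandardFrame : Permutation′ 13 → Ω → Ω → Ω → Ω → Set
MapsStandardFrame ρ a b c d = ρ ⟨$⟩ʳ # 4 ≡ a × ρ ⟨$⟩ʳ # 1 ≡ b × ρ ⟨$⟩ʳ # 0 ≡ c × ρ ⟨$⟩ʳ # 8 ≡ d

FrameMap : Ω → Ω → Ω → Ω → Set
FrameMap a b c d = ∃[ ρ ] InPΓL₃3 ρ × MapsStandardFrame ρ a b c d

-- reduce to the frame g⁻¹ a, g⁻¹ b, g⁻¹ c, g⁻¹ d
frame-map-via : ∀ g → InPΓL₃3 g → ∀ {a b c d a′ b′ c′ d′} →
  g ⟨$⟩ʳ a′ ≡ a → g ⟨$⟩ʳ b′ ≡ b → g ⟨$⟩ʳ c′ ≡ c → g ⟨$⟩ʳ d′ ≡ d →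
  (Frame a′ b′ c′ d′ → FrameMap a′ b′ c′ d′) → Frame a b c d → FrameMap a b c d
frame-map-via g g-PΓL {a′ = a′} {b′} {c′} {d′} refl refl refl refl reduced fr =
  let module g = Collineation-properties g (PΓL⇒collineation g g-PΓL)
      ρ , ρ-PΓL , ρ₄ , ρ₁ , ρ₀ , ρ₈ = reduced (from (g.frame⇔ {a′} {b′} {c′} {d′}) fr)
  in ρ ∘ₚ g , PΓL-∘ₚ ρ g ρ-PΓL g-PΓL
     , cong (g ⟨$⟩ʳ_) ρ₄ , cong (g ⟨$⟩ʳ_) ρ₁ , cong (g ⟨$⟩ʳ_) ρ₀ , cong (g ⟨$⟩ʳ_) ρ₈

frame-map₄ : ∀ {d} → Frame (# 4) (# 1) (# 0) d → FrameMap (# 4) (# 1) (# 0) d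
frame-map₄ {d} fr = R₄ d , R₄-PΓL d , R₄-maps d fr

frame-map₃ : ∀ {c d} → Frame (# 4) (# 1) c d → FrameMap (# 4) (# 1) c d
frame-map₃ {c} fr = let g₄ , g₁ , g₀ = R₃-maps c (Frame.¬abc fr) in
  frame-map-via (R₃ c) (R₃-PΓL c) g₄ g₁ g₀ (inverseʳ (R₃ c)) frame-map₄ fr

frame-map₂ : ∀ {b c d} → Frame (# 4) b c d → FrameMap (# 4) b c d
frame-map₂ {b} fr = let g₄ , g₁ = R₂-maps b (noncollinear⇒≢ (Frame.¬abc fr)) in
  frame-map-via (R₂ b) (R₂-PΓL b) g₄ g₁ (inverseʳ (R₂ b)) (inverseʳ (R₂ b)) frame-map₃ fr

frame-map : ∀ {a b c d} → Frame a b c d → FrameMap a b c d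
frame-map {a} = frame-map-via (R₁ a) (R₁-PΓL a)
  (R₁-maps a) (inverseʳ (R₁ a)) (inverseʳ (R₁ a)) (inverseʳ (R₁ a)) frame-map₂

IsMeet : Ω → Ω → Ω → Ω → Ω → Set
IsMeet p u v w x = u ≢ v × w ≢ x × join u v ≢ join w x × p ∈ line (join u v) × p ∈ line (join w x)

isMeet? : ∀ p u v w x → Dec (IsMeet p u v w x)
isMeet? p u v w x = ¬? (u ≟ᶠ v) ×-dec ¬? (w ≟ᶠ x) ×-dec ¬? (join u v ≟ᶠ join w x)
  ×-dec p ∈? line (join u v) ×-dec p ∈? line (join w x)

module _ (σ ρ : Permutation′ 13) (σ-coll : Collineation σ) (ρ-coll : Collineation ρ) where

  Agree : Ω → Set
  Agree p = σ ⟨$⟩ʳ p ≡ ρ ⟨$⟩ʳ p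

  private
    module σ = Collineation-properties σ σ-coll
    module ρ = Collineation-properties ρ ρ-coll

    same-lineMap : ∀ {u v} → u ≢ v → Agree u → Agree v → σ.lineMap (join u v) ≡ ρ.lineMap (join u v)
    same-lineMap u≢v σu≡ρu σv≡ρv =
      trans (σ.lineMap-join u≢v) (trans (cong₂ join σu≡ρu σv≡ρv) (sym (ρ.lineMap-join u≢v)))

  meet-agrees : ∀ p u v w x {_ : True (isMeet? p u v w x)} → Agree u → Agree v → Agree w → Agree x → Agree p
  meet-agrees p u v w x {isMeet} au av aw ax =
    let u≢v , w≢x , uv≢wx , p∈uv , p∈wx = toWitness isMeet
        on : ∀ {y z} → y ≢ z → Agree y → Agree z → p ∈ line (join y z) → ρ ⟨$⟩ʳ p ∈ line (σ.lineMap (join y z))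
        on {y} {z} y≢z ay az p∈yz =
          subst (λ N → ρ ⟨$⟩ʳ p ∈ line N) (sym (same-lineMap y≢z ay az)) (to (ρ.∈-lineMap⇔ (join y z) p) p∈yz)
    in two-lines-meet-once {σ.lineMap (join u v)} {σ.lineMap (join w x)} (uv≢wx ∘ σ.lineMap-injective)
         (to (σ.∈-lineMap⇔ (join u v) p) p∈uv) (on u≢v au av p∈uv)
         (to (σ.∈-lineMap⇔ (join w x) p) p∈wx) (on w≢x aw ax p∈wx)

  -- every other point is the meet of two lines through points reached before it
  agree-everywhere : Agree (# 4) → Agree (# 1) → Agree (# 0) → Agree (# 8) → ∀ p → Agree p
  agree-everywhere a₄ a₁ a₀ a₈ p =
    All.lookup {P = Agree} {xs = allFin 13}
      (a₀ ∷ a₁ ∷ a₂ ∷ a₃ ∷ a₄ ∷ a₅ ∷ a₆ ∷ a₇ ∷ a₈ ∷ a₉ ∷ a₁₀ ∷ a₁₁ ∷ a₁₂ ∷ []) (∈-allFin p)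
    where
    a₂ : Agree (# 2)
    a₂ = meet-agrees (# 2) (# 4) (# 8) (# 0) (# 1) a₄ a₈ a₀ a₁
    a₅ : Agree (# 5)
    a₅ = meet-agrees (# 5) (# 1) (# 8) (# 0) (# 4) a₁ a₈ a₀ a₄
    a₇ : Agree (# 7)
    a₇ = meet-agrees (# 7) (# 1) (# 4) (# 0) (# 8) a₁ a₄ a₀ a₈
    a₃ : Agree (# 3)
    a₃ = meet-agrees (# 3) (# 1) (# 2) (# 5) (# 7) a₁ a₂ a₅ a₇
    a₆ : Agree (# 6)
    a₆ = meet-agrees (# 6) (# 4) (# 5) (# 2) (# 7) a₄ a₅ a₂ a₇
    a₉ : Agree (# 9)
    a₉ = meet-agrees (# 9) (# 1) (# 6) (# 0) (# 8) a₁ a₆ a₀ a₈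
    a₁₀ : Agree (# 10)
    a₁₀ = meet-agrees (# 10) (# 4) (# 7) (# 2) (# 5) a₄ a₇ a₂ a₅
    a₁₁ : Agree (# 11)
    a₁₁ = meet-agrees (# 11) (# 4) (# 9) (# 1) (# 8) a₄ a₉ a₁ a₈
    a₁₂ : Agree (# 12)
    a₁₂ = meet-agrees (# 12) (# 4) (# 8) (# 1) (# 6) a₄ a₈ a₁ a₆

-- Aut(C) = PΓL₃(3)

PΓL-resp : ∀ σ ρ → (∀ p → σ ⟨$⟩ʳ p ≡ ρ ⟨$⟩ʳ p) → InPΓL₃3 ρ → InPΓL₃3 σ
PΓL-resp σ ρ σ≗ρ (A , A-inv , H) = A , A-inv , λ p → subst (λ q → SamePoint (A · pt p) (pt q)) (sym (σ≗ρ p)) (H p)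

collineation⇒PΓL : ∀ σ → Collineation σ → InPΓL₃3 σ
collineation⇒PΓL σ σ-coll =
  let module σ = Collineation-properties σ σ-coll
      ρ , ρ-PΓL , ρ₄ , ρ₁ , ρ₀ , ρ₈ = frame-map (to (σ.frame⇔ {# 4} {# 1} {# 0} {# 8}) standard-frame)
      σ≗ρ = agree-everywhere σ ρ σ-coll (PΓL⇒collineation ρ ρ-PΓL) (sym ρ₄) (sym ρ₁) (sym ρ₀) (sym ρ₈)
  in PΓL-resp σ ρ σ≗ρ ρ-PΓL

aut⇔PΓL : ∀ σ → InAut LineCode σ ⇔ InPΓL₃3 σ
aut⇔PΓL σ = mk⇔ (collineation⇒PΓL σ ∘ aut⇒collineation σ)
                (Collineation-properties.preserves-LineCode σ ∘ PΓL⇒collineation σ)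

-- Transitivity on C and C₁

c₀ : Subset 13
c₀ = word (join (# 4) (# 1)) (join (# 4) (# 0))

x₀ : Subset 13
x₀ = ∁ c₀ - # 8

record FrameOn (L₁ L₂ : Line) (d : Ω) : Set where
  constructor frameOn
  field
    {a b c} : Ω
    a∈L₁    : a ∈ line L₁
    a∈L₂    : a ∈ line L₂
    b∈L₁    : b ∈ line L₁
    c∈L₂    : c ∈ line L₂
    isFrame : Frame a b c d

abstract
  frameOn-exists : ∀ {L₁ L₂} → L₁ ≢ L₂ → ∃[ d ] FrameOn L₁ L₂ d
  frameOn-exists {L₁} {L₂} L₁≢L₂ =
    let a , (a∈L₁ , a∈L₂) , b , (b∈L₁ , _) , c , (c∈L₂ , _) , d , fr = search L₁ L₂ L₁≢L₂
    in d , frameOn a∈L₁ a∈L₂ b∈L₁ c∈L₂ fr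
    where
    search : ∀ L₁ L₂ → L₁ ≢ L₂ →
      ∃[ a ] (a ∈ line L₁ × a ∈ line L₂) × ∃[ b ] (b ∈ line L₁ × b ≢ a) × ∃[ c ] (c ∈ line L₂ × c ≢ a) ×
      ∃[ d ] Frame a b c d
    search = decide (all? λ L₁ → all? λ L₂ → ¬? (L₁ ≟ᶠ L₂) →-dec
      any? λ a → (a ∈? line L₁ ×-dec a ∈? line L₂) ×-dec
      any? λ b → (b ∈? line L₁ ×-dec ¬? (b ≟ᶠ a)) ×-dec
      any? λ c → (c ∈? line L₂ ×-dec ¬? (c ≟ᶠ a)) ×-dec any? λ d → frame? a b c d)

frameOn? : ∀ L₁ L₂ d → Dec (FrameOn L₁ L₂ d)
frameOn? L₁ L₂ d = map′
  (λ (a , (a∈L₁ , a∈L₂) , b , b∈L₁ , c , c∈L₂ , fr) → frameOn a∈L₁ a∈L₂ b∈L₁ c∈L₂ fr)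
  (λ (frameOn {a} {b} {c} a∈L₁ a∈L₂ b∈L₁ c∈L₂ fr) → a , (a∈L₁ , a∈L₂) , b , b∈L₁ , c , c∈L₂ , fr)
  (any? λ a → (a ∈? line L₁ ×-dec a ∈? line L₂) ×-dec any? λ b → b ∈? line L₁ ×-dec
   any? λ c → c ∈? line L₂ ×-dec frame? a b c d)

abstract
  -- removing the common point of the two lines from ∁ c₀ leaves a codeword
  neighbours-of-c₀ : ∀ q → q ∉ c₀ → (∁ c₀ - q) ∈ₗ codewords ⊎ FrameOn (join (# 4) (# 1)) (join (# 4) (# 0)) q
  neighbours-of-c₀ = decide (all? λ q → ¬? (q ∈? c₀) →-dec
    ((∁ c₀ - q) ∈ₗ? codewords ⊎-dec frameOn? (join (# 4) (# 1)) (join (# 4) (# 0)) q))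

word-frame-map : ∀ {L₁ L₂ d} → FrameOn L₁ L₂ d →
  ∃[ ρ ] InPΓL₃3 ρ × image ρ c₀ ≡ word L₁ L₂ × image ρ x₀ ≡ ∁ (word L₁ L₂) - d
word-frame-map {L₁} {L₂} {d} (frameOn {a} {b} {c} a∈L₁ a∈L₂ b∈L₁ c∈L₂ fr) = transport (frame-map fr)
  where
  open ≡-Reasoning
  L₁≡ab : L₁ ≡ join a b
  L₁≡ab = join-unique {a} {b} {L₁} (noncollinear⇒≢ {a} {b} {c} (Frame.¬abc fr)) a∈L₁ b∈L₁
  L₂≡ac : L₂ ≡ join a c
  L₂≡ac = join-unique {a} {c} {L₂} (noncollinear⇒≢ {a} {c} {d} (Frame.¬acd fr)) a∈L₂ c∈L₂

  transport : FrameMap a b c d → ∃[ ρ ] InPΓL₃3 ρ × image ρ c₀ ≡ word L₁ L₂ × image ρ x₀ ≡ ∁ (word L₁ L₂) - d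
  transport (ρ , ρ-PΓL , ρ₄ , ρ₁ , ρ₀ , ρ₈) = ρ , ρ-PΓL , ρc₀≡ , (begin
      image ρ (∁ c₀ - # 8)           ≡⟨ image-─ ρ (∁ c₀) (# 8) ⟩
      image ρ (∁ c₀) - (ρ ⟨$⟩ʳ # 8)  ≡⟨ cong₂ _-_ (trans (image-∁ ρ c₀) (cong ∁ ρc₀≡)) ρ₈ ⟩
      ∁ (word L₁ L₂) - d             ∎)
    where
    module ρ = Collineation-properties ρ (PΓL⇒collineation ρ ρ-PΓL)
    ρc₀≡ : image ρ c₀ ≡ word L₁ L₂
    ρc₀≡ = begin
      image ρ c₀                     ≡⟨ ρ.image-word (join (# 4) (# 1)) (join (# 4) (# 0)) ⟩
      word (ρ.lineMap (join (# 4) (# 1))) (ρ.lineMap (join (# 4) (# 0)))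
        ≡⟨ cong₂ word (ρ.lineMap-join {# 4} {# 1} (λ ())) (ρ.lineMap-join {# 4} {# 0} (λ ())) ⟩
      word (join (ρ ⟨$⟩ʳ # 4) (ρ ⟨$⟩ʳ # 1)) (join (ρ ⟨$⟩ʳ # 4) (ρ ⟨$⟩ʳ # 0))
        ≡⟨ cong₂ word (cong₂ join ρ₄ ρ₁) (cong₂ join ρ₄ ρ₀) ⟩
      word (join a b) (join a c)     ≡⟨ cong₂ word L₁≡ab L₂≡ac ⟨
      word L₁ L₂                     ∎

reach-codeword : ∀ s → LineCode s → ∃[ g ] InAut LineCode g × image g c₀ ≡ s
reach-codeword s (L₁ , L₂ , L₁≢L₂ , refl) = reached (word-frame-map (proj₂ (frameOn-exists L₁≢L₂)))
  where
  reached : ∀ {d} → ∃[ ρ ] InPΓL₃3 ρ × image ρ c₀ ≡ word L₁ L₂ × image ρ x₀ ≡ ∁ (word L₁ L₂) - d →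
            ∃[ g ] InAut LineCode g × image g c₀ ≡ word L₁ L₂
  reached (ρ , ρ-PΓL , ρc₀≡ , _) = ρ , from (aut⇔PΓL ρ) ρ-PΓL , ρc₀≡

disjoint⇒⊆∁ : ∀ {n} {x c : Subset n} → x ∩ c ≡ ⊥ → x ⊆ ∁ c
disjoint⇒⊆∁ x∩c≡⊥ {i} i∈x = x∉p⇒x∈∁p λ i∈c → ∉⊥ (subst (i ∈_) x∩c≡⊥ (x∈p∩q⁺ (i∈x , i∈c)))

-- x avoids a codeword c, so x = ∁ c − q; after moving c to c₀, either q is the
-- common point of the two lines (and x would be a codeword) or a frame moves x₀ to x.
reach-neighbour : ∀ x → C₁ LineCode x → ∃[ g ] InAut LineCode g × image g x₀ ≡ x
reach-neighbour x (x-vertex , x∉C , c , c∈C , _ , c-vertex , x∩c≡⊥) =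
  let q , q∈∁c , x≡∁c-q = ⊆∧∣∣≡suc⇒≡- (disjoint⇒⊆∁ x∩c≡⊥) ∣∁c∣≡1+∣x∣
  in reached q (x∈∁p⇒x∉p q∈∁c) x≡∁c-q (reach-codeword c c∈C)
  where
  open ≡-Reasoning
  ∣∁c∣≡1+∣x∣ : ∣ ∁ c ∣ ≡ suc ∣ x ∣
  ∣∁c∣≡1+∣x∣ = trans (∣∁p∣≡n∸∣p∣ c) (trans (cong (13 ∸_) c-vertex) (cong suc (sym x-vertex)))

  reached : ∀ q → q ∉ c → x ≡ ∁ c - q → ∃[ g ] InAut LineCode g × image g c₀ ≡ c →
            ∃[ g ] InAut LineCode g × image g x₀ ≡ x
  reached q q∉c x≡∁c-q (g , g-aut , gc₀≡c) = cases (neighbours-of-c₀ q′ q′∉c₀)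
    where
    q′ : Ω
    q′ = g ⟨$⟩ˡ q

    q′∉c₀ : q′ ∉ c₀
    q′∉c₀ q′∈c₀ = q∉c (subst₂ _∈_ (inverseʳ g) gc₀≡c (from (∈-image⇔ g) q′∈c₀))

    g[∁c₀-q′]≡x : image g (∁ c₀ - q′) ≡ x
    g[∁c₀-q′]≡x = begin
      image g (∁ c₀ - q′)          ≡⟨ image-─ g (∁ c₀) q′ ⟩
      image g (∁ c₀) - (g ⟨$⟩ʳ q′) ≡⟨ cong₂ _-_ (trans (image-∁ g c₀) (cong ∁ gc₀≡c)) (inverseʳ g) ⟩
      ∁ c - q                      ≡⟨ x≡∁c-q ⟨
      x                            ∎

    moved : ∃[ ρ ] InPΓL₃3 ρ × image ρ c₀ ≡ c₀ × image ρ x₀ ≡ ∁ c₀ - q′ →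
            ∃[ g ] InAut LineCode g × image g x₀ ≡ x
    moved (h , h-PΓL , _ , hx₀≡) = h ∘ₚ g , InAut-∘ₚ h g (from (aut⇔PΓL h) h-PΓL) g-aut , (begin
      image (h ∘ₚ g) x₀     ≡⟨ image-∘ₚ h g x₀ ⟩
      image g (image h x₀)  ≡⟨ cong (image g) hx₀≡ ⟩
      image g (∁ c₀ - q′)   ≡⟨ g[∁c₀-q′]≡x ⟩
      x                     ∎)

    cases : (∁ c₀ - q′) ∈ₗ codewords ⊎ FrameOn (join (# 4) (# 1)) (join (# 4) (# 0)) q′ →
            ∃[ g ] InAut LineCode g × image g x₀ ≡ x
    cases (inj₁ listed) =
      ⊥-elim (x∉C (subst LineCode g[∁c₀-q′]≡x (to (g-aut (∁ c₀ - q′)) (from (∈-codewords⇔ (∁ c₀ - q′)) listed))))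
    cases (inj₂ on) = moved (word-frame-map on)

size-78 : HasSize LineCode 78
size-78 = codewords , codewords-unique , refl , ∈-codewords⇔

walk-length-pos : ∀ {x y m} → x ≢ y → Walk x y m → 1 ≤ m
walk-length-pos x≢y (nil _)    = ⊥-elim (x≢y refl)
walk-length-pos _   (step _ _) = s≤s z≤n

c₀′ : Subset 13
c₀′ = word (# 2) (# 3)

abstract
  c₀≢c₀′ : c₀ ≢ c₀′
  c₀≢c₀′ = decide (¬? (≡-decᵛ _≟ᵇ_ c₀ c₀′))

  x₀∉codewords : ¬ x₀ ∈ₗ codewords
  x₀∉codewords = decide (¬? (x₀ ∈ₗ? codewords))

minimum-distance-1 : MinDist LineCode 1
minimum-distance-1 =
  (c₀ , c₀′ , (join (# 4) (# 1) , join (# 4) (# 0) , (λ ()) , refl) , (# 2 , # 3 , (λ ()) , refl) , c₀≢c₀′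
     , step (refl , refl , refl) (nil refl) , λ _ → walk-length-pos c₀≢c₀′)
  , λ _ _ _ _ c≢c′ _ → walk-length-pos c≢c′

neighbour-transitive : NeighbourTransitive LineCode
neighbour-transitive =
  (x₀ , refl , x₀∉codewords ∘ to (∈-codewords⇔ x₀) , c₀ , (join (# 4) (# 1) , join (# 4) (# 0) , (λ ()) , refl)
      , refl , refl , refl)
  , transitive-from {C = LineCode} LineCode c₀ reach-codeword
  , transitive-from {C = LineCode} (C₁ LineCode) x₀ reach-neighbour

lemma6p2 : NeighbourTransitive LineCode
    × HasSize LineCode 78
    × MinDist LineCode 1
    × (∀ (σ : Permutation′ 13) → InAut LineCode σ ⇔ InPΓL₃3 σ)
lemma6p2 = neighbour-transitive , size-78 , minimum-distance-1 , aut⇔PΓL
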